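{- Let $P$ be a (loopless) polymatroid on $E$ and let $\mathscr G$ be the set of all nonempty flats of $P$. Then the Bergman fan $\Sigma_{P,\mathscr G}$ coincides with the fan $\Sigma_P$.
   Context: A polymatroid on a finite set $E=\{1,\dots,n\}$ is a function $\mathrm{rk}:2^E\to\mathbb Z_{\ge0}$ that is submodular, monotone, $\mathrm{rk}(\emptyset)=0$, and loopless. Flats are subsets maximal among sets of their rank; $\mathrm{cl}(A)$ is the smallest flat containing $A$. Let $\widetilde E_i=\{1,\dots,\mathrm{rk}_P(i)\}$ (disjoint), $\widetilde E=\bigsqcup_i\widetilde E_i$, $\pi:\widetilde E\to E$ with $\pi^{ -1}(i)=\widetilde E_i$, and $\widetilde P$ the matroid on $\widetilde E$ with $\mathrm{rk}_{\widetilde P}(S)=\min_{A\subseteq E}(\mathrm{rk}_P(A)+|S\setminus\pi^{ -1}(A)|)$. Write $\mathbf e_S=\sum_{i\in S}\mathbf e_i$ in $\mathbb R^{\widetilde E}/\mathbb R(1,\dots,1)$. $\Sigma_{P,\mathscr G}$: let $\widetilde{\mathscr G}=\{\pi^{ -1}(G):G\in\mathscr G\}\cup\{\text{atoms of the lattice of flats of }\widetilde P\}$. A subset $\mathscr N\subseteq\widetilde{\mathscr G}$ is nested if for any pairwise incomparable $F_1,\dots,F_k\in\mathscr N$ with $k\ge2$, $\mathrm{cl}_{\widetilde P}(F_1\cup\cdots\cup F_k)\notin\widetilde{\mathscr G}$. $\Sigma_{P,\mathscr G}$ is the collection of cones $\mathrm{cone}(\mathbf e_S:S\in\mathscr N)$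 over all nested $\mathscr N$ with $\widetilde E\notin\mathscr N$. $\Sigma_P$: the collection of cones $\sigma_{\mathscr F,S}=\mathrm{cone}(\mathbf e_{\pi^{ -1}(F_1)},\dots,\mathbf e_{\pi^{ -1}(F_k)})+\mathrm{cone}(\mathbf e_i)_{i\in S}$, one for each chain of flats $\mathscr F=\{\emptyset=F_0\subsetneq F_1\subsetneq\cdots\subsetneq F_k\subsetneq E\}$ and each $S\subseteq\widetilde E$ such that $\mathrm{rk}(F\cup\pi(T))>\mathrm{rk}(F)+|T|$ for every proper flat $F$ in $\mathscr F$ and every nonempty $T\subseteq S\setminus\pi^{ -1}(F)$.
   Formalization: The cones of $\Sigma_{P,\mathscr G}$ and $\Sigma_P$ are compared as sets of points with rational coordinates, in ℚ^Ẽ/ℚ(1,…,1) rather than $\mathbb R^{\widetilde E}/\mathbb R(1,\dots,1)$. -}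

module Defs where

open import Data.Bool using (Bool; true; false; if_then_else_; _∧_)
open import Data.Nat using (ℕ; zero; suc; _+_; _<_; _≤_; _⊓_)
open import Data.Fin using (Fin; _≟_)
open import Data.Fin.Subset
  using (Subset; ⊥; ⊤; ⁅_⁆; _∈_; _∉_; _⊆_; _⊂_; _∪_; _∩_; _─_; ∣_∣; Nonempty)
open import Data.List using (List; []; _∷_; _++_; map; foldr; length; concatMap; replicate; allFin; filterᵇ)
open import Data.Bool.ListAction using (any)
open import Data.List.Membership.Propositional using () renaming (_∈_ to _∈ˡ_)
open import Data.List.Relation.Unary.All using (All)
open import Data.List.Relation.Unary.AllPairs using (AllPairs)
open import Data.Vec using (Vec; []; _∷_; lookup; tabulate)
open import Data.Product using (Σ; ∃; _×_; _,_; proj₁; proj₂)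
open import Data.Sum using (_⊎_)
open import Data.Rational using (ℚ; 0ℚ) renaming (_+_ to _+ℚ_; _≤_ to _≤ℚ_)
open import Relation.Nullary using (¬_; ⌊_⌋)
open import Relation.Binary.PropositionalEquality using (_≡_)
open import Function using (_⇔_)

-- Polymatroids on E = Fin n (subsets are Data.Fin.Subset, i.e. Vec Bool n)

record Polymatroid (n : ℕ) : Set where
  field
    rk        : Subset n → ℕ
    rk-∅      : rk ⊥ ≡ 0
    monotone  : ∀ A B → A ⊆ B → rk A ≤ rk B
    submod    : ∀ A B → rk (A ∪ B) + rk (A ∩ B) ≤ rk A + rk B
    loopless  : ∀ i → 0 < rk ⁅ i ⁆

IsFlat : ∀ {k} → (Subset k → ℕ) → Subset k → Set
IsFlat r F = ∀ G → F ⊂ G → ¬ (r G ≡ r F)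

IsClosure : ∀ {k} → (Subset k → ℕ) → Subset k → Subset k → Set
IsClosure r A C = IsFlat r C × A ⊆ C × (∀ F → IsFlat r F → A ⊆ F → C ⊆ F)

IsBottomFlat : ∀ {k} → (Subset k → ℕ) → Subset k → Set
IsBottomFlat r H = IsFlat r H × (∀ F → IsFlat r F → H ⊆ F)

IsAtom : ∀ {k} → (Subset k → ℕ) → Subset k → Set
IsAtom r F = IsFlat r F × ¬ IsBottomFlat r F
           × (∀ G → IsFlat r G → G ⊂ F → IsBottomFlat r G)

allSubsets : ∀ k → List (Subset k)
allSubsets zero    = [] ∷ []
allSubsets (suc k) = map (true ∷_) (allSubsets k) ++ map (false ∷_) (allSubsets k)

minOver : ℕ → List ℕ → ℕ
minOver d xs = foldr _⊓_ d xs

-- The ground set Ẽ = ⊔_i Ẽ_i, with |Ẽ_i| = rk(i), encoded as Fin m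
-- together with the projection π : Ẽ → E.

module Lift {n : ℕ} (P : Polymatroid n) where
  open Polymatroid P

  πList : List (Fin n)
  πList = concatMap (λ i → replicate (rk ⁅ i ⁆) i) (allFin n)

  m : ℕ
  m = length πList

  π : Fin m → Fin n
  π j = Data.List.lookup πList j

  preimage : Subset n → Subset m
  preimage A = tabulate (λ j → lookup A (π j))

  image : Subset m → Subset n
  image T = tabulate (λ i → any (λ j → lookup T j ∧ ⌊ π j ≟ i ⌋) (allFin m))

  rkT : Subset m → ℕ
  rkT S = minOver (rk ⊥ + ∣ S ∣)
                  (map (λ A → rk A + ∣ S ─ preimage A ∣) (allSubsets n))

  InG : Subset n → Set
  InG G = IsFlat rk G × Nonempty G

  InGt : Subset m → Set
  InGt X = (Σ (Subset n) λ G → InG G × X ≡ preimage G) ⊎ IsAtom rkT X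

  unionAll : List (Subset m) → Subset m
  unionAll = foldr _∪_ ⊥

  Incomparable : Subset m → Subset m → Set
  Incomparable A B = ¬ (A ⊆ B) × ¬ (B ⊆ A)

  IsNested : List (Subset m) → Set
  IsNested N =
    All InGt N ×
    (∀ (L : List (Subset m)) → All (_∈ˡ N) L → 2 ≤ length L →
       AllPairs Incomparable L →
       ∀ C → IsClosure rkT (unionAll L) C → ¬ InGt C)

  -- chains ∅ = F₀ ⊊ F₁ ⊊ ⋯ ⊊ F_k ⊊ E of flats of P, given as [F₁,…,F_k]
  data StrictChainFrom (F : Subset n) : List (Subset n) → Set where
    end  : F ⊂ ⊤ → StrictChainFrom F []
    step : ∀ {G Gs} → IsFlat rk G → F ⊂ G → StrictChainFrom G Gs →
           StrictChainFrom F (G ∷ Gs)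

  IsFlagOfFlats : List (Subset n) → Set
  IsFlagOfFlats Fs = IsFlat rk ⊥ × StrictChainFrom ⊥ Fs

  Admissible : List (Subset n) → Subset m → Set
  Admissible Fs S =
    ∀ F → F ∈ˡ (⊥ ∷ Fs) → ∀ (T : Subset m) → Nonempty T →
      T ⊆ (S ─ preimage F) → rk F + ∣ T ∣ < rk (F ∪ image T)

  elementsOf : Subset m → List (Fin m)
  elementsOf S = filterᵇ (lookup S) (allFin m)

  -- generators (as index sets S, meaning e_S) of the cone σ_{𝓕,S}
  gensΣP : List (Subset n) → Subset m → List (Subset m)
  gensΣP Fs S = map preimage Fs ++ map ⁅_⁆ (elementsOf S)

lincomb : ∀ {k} → List (ℚ × Subset k) → Fin k → ℚ
lincomb []             j = 0ℚ
lincomb ((c , S) ∷ cs) j = (if lookup S j then c else 0ℚ) +ℚ lincomb cs j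

-- x (a representative in ℚ^k) lies in cone(e_S : S ∈ gens) modulo ℚ(1,…,1)
InCone : ∀ {k} → List (Subset k) → (Fin k → ℚ) → Set
InCone {k} gens x =
  Σ (List (ℚ × Subset k)) λ cs → map proj₂ cs ≡ gens × All (λ c → 0ℚ ≤ℚ c) (map proj₁ cs)
    × Σ ℚ λ a → ∀ j → x j ≡ lincomb cs j +ℚ a

SameCone : ∀ {k} → List (Subset k) → List (Subset k) → Set
SameCone g₁ g₂ = ∀ x → (InCone g₁ x → InCone g₂ x) × (InCone g₂ x → InCone g₁ x)

module _ {n : ℕ} (P : Polymatroid n) where
  open Lift P

  BergmanConesInΣP : Set
  BergmanConesInΣP =
    ∀ (N : List (Subset m)) → IsNested N → ¬ (⊤ ∈ˡ N) →
      Σ (List (Subset n)) λ Fs → Σ (Subset m) λ S →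
        IsFlagOfFlats Fs × Admissible Fs S × SameCone N (gensΣP Fs S)

  ΣPConesInBergman : Set
  ΣPConesInBergman =
    ∀ (Fs : List (Subset n)) (S : Subset m) → IsFlagOfFlats Fs → Admissible Fs S →
      Σ (List (Subset m)) λ N → IsNested N × ¬ (⊤ ∈ˡ N) × SameCone N (gensΣP Fs S)

  BergmanFanEqualsΣP : Set
  BergmanFanEqualsΣP = BergmanConesInΣP × ΣPConesInBergman

-- Everything rests on one computation in the matroid P̃. Let F be a flat of P and T ⊆ Ẽ ∖ π⁻¹(F) be free over F,
-- i.e. rk(F ∪ π T₀) > rk F + ∣ T₀ ∣ for every nonempty T₀ ⊆ T. Then π⁻¹(F) ∪ T is a flat of P̃ of rank rk F + ∣ T ∣:
-- rk_P̃ is a minimum over A ⊆ E, and splitting T along π⁻¹(A) bounds every term from below.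
-- Σ_P ⊆ Σ_{P,𝒢}: the union of an antichain of generators of σ_{𝓕,S} is such a flat π⁻¹(F) ∪ T with T nonempty,
-- which is no preimage (a whole fibre is never free) and no atom (it strictly contains a member of the antichain).
-- Σ_{P,𝒢} ⊆ Σ_P: the atoms of P̃ are the singletons {j} with rk(π j) ≥ 2 and preimages of flats, so a nested set
-- consists of preimages of pairwise comparable flats (else their join would be in 𝒢̃) and of such singletons.
-- A smallest T violating admissibility would make the closure of the antichain π⁻¹(F) ∪ T equal to
-- π⁻¹(cl(F ∪ π T)) ∈ 𝒢̃.

module Submission where

open import Data.Bool using (Bool; true; false; if_then_else_; _∧_)
import Data.Bool as Bool
open import Data.Bool.Properties using (T-≡; T-∧; T?)
open import Data.Nat using (ℕ; zero; suc; _+_; _≤_; _<_; _⊓_; z≤n; s≤s)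
open import Data.Nat.Properties
open import Data.Nat.ListAction using (sum)
open import Algebra.Bundles using (CommutativeMonoid)
open import Algebra.Properties.CommutativeSemigroup +-commutativeSemigroup
  using () renaming (interchange to +-interchange)
open import Data.Fin using (Fin)
import Data.Fin as Fin
open import Data.Fin.Subset
  using (Subset; ⊥; ⊤; ⁅_⁆; _∈_; _∉_; _⊆_; _⊂_; _∪_; _∩_; _─_; ∣_∣; Nonempty; Empty; inside; outside)
open import Data.Fin.Subset.Properties
open import Data.Vec using ([]; _∷_; lookup; tabulate)
import Data.Vec as Vec
open import Data.Vec.Properties using (lookup⇒[]=; []=⇒lookup; lookup∘tabulate; tabulate∘lookup; ≡-dec)
open import Data.List using (List; []; _∷_; _++_; map; foldr; length; filterᵇ; allFin; concatMap; replicate)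
import Data.List as List
open import Data.List.Properties
  using (length-map; length-++; length-replicate; tabulate-lookup; foldr-preservesᵇ; foldr-preservesᵒ;
         filter-++; filter-all; filter-none)
open import Data.List.Membership.Propositional using () renaming (_∈_ to _∈ˡ_)
open import Data.List.Membership.Propositional.Properties
  using (∈-map⁺; ∈-map⁻; ∈-++⁺ˡ; ∈-++⁺ʳ; ∈-++⁻; ∈-allFin; ∈-filter⁺; ∈-filter⁻; ∈-concatMap⁺)
open import Data.List.Relation.Unary.Any using (here; there)
import Data.List.Relation.Unary.Any as Any
open import Data.List.Relation.Unary.Any.Properties using (any⁺; any⁻; lookup-index)
open import Data.List.Relation.Unary.All using (All; []; _∷_)
import Data.List.Relation.Unary.All as All
import Data.List.Relation.Unary.All.Properties as All
open import Data.List.Relation.Unary.AllPairs using (AllPairs; []; _∷_)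
import Data.List.Relation.Unary.AllPairs.Properties as AllPairs
open import Data.Product using (Σ; ∃; _×_; _,_; proj₁; proj₂)
open import Data.Sum using (_⊎_; inj₁; inj₂; [_,_]′)
open import Data.Empty using (⊥-elim)
open import Function using (_∘_; id; Equivalence; case_of_)
open import Relation.Nullary using (¬_; Dec; yes; no; ⌊_⌋; _×-dec_)
open import Relation.Nullary.Decidable using (decidable-stable; toWitness; fromWitness)
open import Relation.Binary.PropositionalEquality

open import Defs

⋃ : ∀ {k} → List (Subset k) → Subset k
⋃ = foldr _∪_ ⊥

elements : ∀ {k} → Subset k → List (Fin k)
elements {k} p = filterᵇ (lookup p) (allFin k)

∈⇒T-lookup : ∀ {k} {p : Subset k} {x} → x ∈ p → Bool.T (lookup p x)
∈⇒T-lookup x∈p = Equivalence.from T-≡ ([]=⇒lookup x∈p)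

T-lookup⇒∈ : ∀ {k} {p : Subset k} {x} → Bool.T (lookup p x) → x ∈ p
T-lookup⇒∈ {p = p} {x} t = lookup⇒[]= x p (Equivalence.to T-≡ t)

∈-tabulate⁺ : ∀ {k} {f : Fin k → Bool} {x} → Bool.T (f x) → x ∈ tabulate f
∈-tabulate⁺ {f = f} {x} t = T-lookup⇒∈ (subst Bool.T (sym (lookup∘tabulate f x)) t)

∈-tabulate⁻ : ∀ {k} {f : Fin k → Bool} {x} → x ∈ tabulate f → Bool.T (f x)
∈-tabulate⁻ {f = f} {x} x∈ = subst Bool.T (lookup∘tabulate f x) (∈⇒T-lookup x∈)

x∈p─q⇒x∉q : ∀ {k} (p q : Subset k) {x} → x ∈ p ─ q → x ∉ q
x∈p─q⇒x∉q (inside ∷ p) (outside ∷ q) Vec.here        ()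
x∈p─q⇒x∉q (_ ∷ p)      (_ ∷ q)       (Vec.there x∈) (Vec.there x∈q) = x∈p─q⇒x∉q p q x∈ x∈q

x∈p─q⁻ : ∀ {k} (p q : Subset k) {x} → x ∈ p ─ q → x ∈ p × x ∉ q
x∈p─q⁻ p q x∈ = p─q⊆p p q x∈ , x∈p─q⇒x∉q p q x∈

⊈⇒∃ : ∀ {k} {p q : Subset k} → ¬ p ⊆ q → ∃ λ x → x ∈ p × x ∉ q
⊈⇒∃ {p = p} {q} p⊈q with nonempty? (p ─ q)
... | yes (x , x∈) = x , x∈p─q⁻ p q x∈
... | no ∄ = ⊥-elim (p⊈q λ {x} x∈p → decidable-stable (x ∈? q) λ x∉q → ∄ (x , x∈p∧x∉q⇒x∈p─q x∈p x∉q))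

∪-least : ∀ {k} {p q r : Subset k} → p ⊆ r → q ⊆ r → p ∪ q ⊆ r
∪-least {p = p} {q} p⊆r q⊆r x∈ = [ p⊆r , q⊆r ]′ (x∈p∪q⁻ p q x∈)

∩-greatest : ∀ {k} {p q r : Subset k} → r ⊆ p → r ⊆ q → r ⊆ p ∩ q
∩-greatest r⊆p r⊆q x∈ = x∈p∩q⁺ (r⊆p x∈ , r⊆q x∈)

p⊆q∪[p─q] : ∀ {k} (p q : Subset k) → p ⊆ q ∪ (p ─ q)
p⊆q∪[p─q] p q {x} x∈p with x ∈? q
... | yes x∈q = p⊆p∪q (p ─ q) x∈q
... | no  x∉q = q⊆p∪q q (p ─ q) (x∈p∧x∉q⇒x∈p─q x∈p x∉q)

─-monoˡ : ∀ {k} {p q : Subset k} (r : Subset k) → p ⊆ q → p ─ r ⊆ q ─ r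
─-monoˡ {p = p} r p⊆q x∈ = let x∈p , x∉r = x∈p─q⁻ p r x∈ in x∈p∧x∉q⇒x∈p─q (p⊆q x∈p) x∉r

∈-allSubsets : ∀ {k} (p : Subset k) → p ∈ˡ allSubsets k
∈-allSubsets []            = here refl
∈-allSubsets (inside ∷ p)  = ∈-++⁺ˡ (∈-map⁺ (inside ∷_) (∈-allSubsets p))
∈-allSubsets (outside ∷ p) = ∈-++⁺ʳ (map (inside ∷_) (allSubsets _)) (∈-map⁺ (outside ∷_) (∈-allSubsets p))

⁅x⁆⊆ : ∀ {k} {p : Subset k} {x} → x ∈ p → ⁅ x ⁆ ⊆ p
⁅x⁆⊆ {x = x} x∈p y∈ rewrite x∈⁅y⁆⇒x≡y x y∈ = x∈p

[p∪q]─r≡[p─r]∪[q─r] : ∀ {k} (p q r : Subset k) → (p ∪ q) ─ r ≡ (p ─ r) ∪ (q ─ r)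
[p∪q]─r≡[p─r]∪[q─r] p q r = ⊆-antisym
  (λ x∈ → let x∈p∪q , x∉r = x∈p─q⁻ (p ∪ q) r x∈ in
    [ (λ x∈p → p⊆p∪q (q ─ r) (x∈p∧x∉q⇒x∈p─q x∈p x∉r))
    , (λ x∈q → q⊆p∪q (p ─ r) (q ─ r) (x∈p∧x∉q⇒x∈p─q x∈q x∉r)) ]′ (x∈p∪q⁻ p q x∈p∪q))
  (∪-least (─-monoˡ r (p⊆p∪q q)) (─-monoˡ r (q⊆p∪q p q)))

[p∪q]─p≡q : ∀ {k} (p q : Subset k) → (∀ {x} → x ∈ q → x ∉ p) → (p ∪ q) ─ p ≡ q
[p∪q]─p≡q p q q∩p=∅ = ⊆-antisym
  (λ x∈ → let x∈p∪q , x∉p = x∈p─q⁻ (p ∪ q) p x∈ in [ ⊥-elim ∘ x∉p , id ]′ (x∈p∪q⁻ p q x∈p∪q))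
  (λ x∈q → x∈p∧x∉q⇒x∈p─q (q⊆p∪q p q x∈q) (q∩p=∅ x∈q))

⊆-by-size : ∀ {k} {p q : Subset k} → p ⊆ q → ∣ q ∣ ≤ ∣ p ∣ → q ⊆ p
⊆-by-size {p = p} {q} p⊆q ∣q∣≤∣p∣ with q ⊆? p
... | yes q⊆p = q⊆p
... | no  q⊈p = ⊥-elim (<⇒≱ (p⊂q⇒∣p∣<∣q∣ (p⊆q , ⊈⇒∃ q⊈p)) ∣q∣≤∣p∣)

∣p∣>0 : ∀ {k} {p : Subset k} → Nonempty p → 0 < ∣ p ∣
∣p∣>0 {k} {p} (x , x∈p) = subst (_< ∣ p ∣) (∣⊥∣≡0 k) (p⊂q⇒∣p∣<∣q∣ (⊥⊆ , x , x∈p , ∉⊥))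

Empty⇒∣p∣≡0 : ∀ {k} {p : Subset k} → Empty p → ∣ p ∣ ≡ 0
Empty⇒∣p∣≡0 {k} ∄ = trans (cong ∣_∣ (Empty-unique ∄)) (∣⊥∣≡0 k)

∣p∪q∣+∣p∩q∣≡∣p∣+∣q∣ : ∀ {k} (p q : Subset k) → ∣ p ∪ q ∣ + ∣ p ∩ q ∣ ≡ ∣ p ∣ + ∣ q ∣
∣p∪q∣+∣p∩q∣≡∣p∣+∣q∣ []            []            = refl
∣p∪q∣+∣p∩q∣≡∣p∣+∣q∣ (inside ∷ p)  (inside ∷ q)  =
  cong suc (trans (+-suc _ _) (trans (cong suc (∣p∪q∣+∣p∩q∣≡∣p∣+∣q∣ p q)) (sym (+-suc _ _))))
∣p∪q∣+∣p∩q∣≡∣p∣+∣q∣ (inside ∷ p)  (outside ∷ q) = cong suc (∣p∪q∣+∣p∩q∣≡∣p∣+∣q∣ p q)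
∣p∪q∣+∣p∩q∣≡∣p∣+∣q∣ (outside ∷ p) (inside ∷ q)  =
  trans (cong suc (∣p∪q∣+∣p∩q∣≡∣p∣+∣q∣ p q)) (sym (+-suc _ _))
∣p∪q∣+∣p∩q∣≡∣p∣+∣q∣ (outside ∷ p) (outside ∷ q) = ∣p∪q∣+∣p∩q∣≡∣p∣+∣q∣ p q

∣p∪q∣≡∣p∣+∣q∣ : ∀ {k} (p q : Subset k) → Empty (p ∩ q) → ∣ p ∪ q ∣ ≡ ∣ p ∣ + ∣ q ∣
∣p∪q∣≡∣p∣+∣q∣ p q ∄ = begin
  ∣ p ∪ q ∣                 ≡⟨ +-identityʳ _ ⟨
  ∣ p ∪ q ∣ + 0             ≡⟨ cong (∣ p ∪ q ∣ +_) (Empty⇒∣p∣≡0 ∄) ⟨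
  ∣ p ∪ q ∣ + ∣ p ∩ q ∣     ≡⟨ ∣p∪q∣+∣p∩q∣≡∣p∣+∣q∣ p q ⟩
  ∣ p ∣ + ∣ q ∣             ∎
  where open ≡-Reasoning

∣p∣+∣q∣≤∣r∣+∣s∣ : ∀ {k} {p q r s : Subset k} → p ∪ q ⊆ r ∪ s → p ∩ q ⊆ r ∩ s → ∣ p ∣ + ∣ q ∣ ≤ ∣ r ∣ + ∣ s ∣
∣p∣+∣q∣≤∣r∣+∣s∣ {p = p} {q} {r} {s} ∪⊆ ∩⊆ = begin
  ∣ p ∣ + ∣ q ∣                ≡⟨ ∣p∪q∣+∣p∩q∣≡∣p∣+∣q∣ p q ⟨
  ∣ p ∪ q ∣ + ∣ p ∩ q ∣        ≤⟨ +-mono-≤ (p⊆q⇒∣p∣≤∣q∣ ∪⊆) (p⊆q⇒∣p∣≤∣q∣ ∩⊆) ⟩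
  ∣ r ∪ s ∣ + ∣ r ∩ s ∣        ≡⟨ ∣p∪q∣+∣p∩q∣≡∣p∣+∣q∣ r s ⟩
  ∣ r ∣ + ∣ s ∣                ∎
  where open ≤-Reasoning

∣─∣-submodular : ∀ {k} (S S′ : Subset k) {B B′ C D : Subset k} → B ∪ B′ ⊆ C → B ∩ B′ ⊆ D →
                 ∣ (S ∪ S′) ─ C ∣ + ∣ (S ∩ S′) ─ D ∣ ≤ ∣ S ─ B ∣ + ∣ S′ ─ B′ ∣
∣─∣-submodular S S′ {B} {B′} {C} {D} B∪B′⊆C B∩B′⊆D = ∣p∣+∣q∣≤∣r∣+∣s∣ ∪⊆ ∩⊆
  where
  ∉C : ∀ {x} → x ∉ C → x ∉ B × x ∉ B′
  ∉C x∉C = x∉C ∘ B∪B′⊆C ∘ p⊆p∪q B′ , x∉C ∘ B∪B′⊆C ∘ q⊆p∪q B B′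
  ∪⊆ : ((S ∪ S′) ─ C) ∪ ((S ∩ S′) ─ D) ⊆ (S ─ B) ∪ (S′ ─ B′)
  ∪⊆ {x} x∈ with x∈p∪q⁻ _ _ x∈
  ... | inj₁ x∈X = let x∈S∪S′ , x∉C = x∈p─q⁻ (S ∪ S′) C x∈X ; x∉B , x∉B′ = ∉C x∉C in
    [ (λ x∈S → p⊆p∪q (S′ ─ B′) (x∈p∧x∉q⇒x∈p─q x∈S x∉B))
    , (λ x∈S′ → q⊆p∪q (S ─ B) (S′ ─ B′) (x∈p∧x∉q⇒x∈p─q x∈S′ x∉B′)) ]′ (x∈p∪q⁻ S S′ x∈S∪S′)
  ... | inj₂ x∈Y with x∈p─q⁻ (S ∩ S′) D x∈Y | x ∈? B
  ...   | x∈S∩S′ , _   | no  x∉B = p⊆p∪q (S′ ─ B′) (x∈p∧x∉q⇒x∈p─q (p∩q⊆p S S′ x∈S∩S′) x∉B)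
  ...   | x∈S∩S′ , x∉D | yes x∈B = q⊆p∪q (S ─ B) (S′ ─ B′)
                                     (x∈p∧x∉q⇒x∈p─q (p∩q⊆q S S′ x∈S∩S′) λ x∈B′ → x∉D (B∩B′⊆D (x∈p∩q⁺ (x∈B , x∈B′))))
  ∩⊆ : ((S ∪ S′) ─ C) ∩ ((S ∩ S′) ─ D) ⊆ (S ─ B) ∩ (S′ ─ B′)
  ∩⊆ x∈ with x∈p∩q⁻ _ _ x∈
  ... | x∈X , x∈Y with ∉C (proj₂ (x∈p─q⁻ (S ∪ S′) C x∈X)) | x∈p∩q⁻ S S′ (proj₁ (x∈p─q⁻ (S ∩ S′) D x∈Y))
  ...   | x∉B , x∉B′ | x∈S , x∈S′ = x∈p∩q⁺ (x∈p∧x∉q⇒x∈p─q x∈S x∉B , x∈p∧x∉q⇒x∈p─q x∈S′ x∉B′)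

∣p─p∣≡0 : ∀ {k} (p : Subset k) → ∣ p ─ p ∣ ≡ 0
∣p─p∣≡0 p = Empty⇒∣p∣≡0 λ (x , x∈) → let x∈p , x∉p = x∈p─q⁻ p p x∈ in x∉p x∈p

∣p∣≡∣p∩q∣+∣p─q∣ : ∀ {k} (p q : Subset k) → ∣ p ∣ ≡ ∣ p ∩ q ∣ + ∣ p ─ q ∣
∣p∣≡∣p∩q∣+∣p─q∣ []            []            = refl
∣p∣≡∣p∩q∣+∣p─q∣ (inside ∷ p)  (inside ∷ q)  = cong suc (∣p∣≡∣p∩q∣+∣p─q∣ p q)
∣p∣≡∣p∩q∣+∣p─q∣ (inside ∷ p)  (outside ∷ q) = trans (cong suc (∣p∣≡∣p∩q∣+∣p─q∣ p q)) (sym (+-suc _ _))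
∣p∣≡∣p∩q∣+∣p─q∣ (outside ∷ p) (inside ∷ q)  = ∣p∣≡∣p∩q∣+∣p─q∣ p q
∣p∣≡∣p∩q∣+∣p─q∣ (outside ∷ p) (outside ∷ q) = ∣p∣≡∣p∩q∣+∣p─q∣ p q

∣p∣≡1+∣p-x∣ : ∀ {k} {p : Subset k} {x} → x ∈ p → ∣ p ∣ ≡ suc ∣ p ─ ⁅ x ⁆ ∣
∣p∣≡1+∣p-x∣ {p = p} {x} x∈p = trans (∣p∣≡∣p∩q∣+∣p─q∣ p ⁅ x ⁆) (cong (_+ ∣ p ─ ⁅ x ⁆ ∣) ∣p∩⁅x⁆∣≡1)
  where ∣p∩⁅x⁆∣≡1 = trans (cong ∣_∣ (⊆-antisym (p∩q⊆q p ⁅ x ⁆) (∩-greatest (⁅x⁆⊆ x∈p) id))) (∣⁅x⁆∣≡1 x)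

∣tabulate∣≡length-filter : ∀ {k} {A : Set} (f : A → Bool) (g : Fin k → A) →
                          ∣ tabulate (f ∘ g) ∣ ≡ length (filterᵇ f (List.tabulate g))
∣tabulate∣≡length-filter {zero}  f g = refl
∣tabulate∣≡length-filter {suc k} f g with f (g Fin.zero)
... | true  = cong suc (∣tabulate∣≡length-filter f (g ∘ Fin.suc))
... | false = ∣tabulate∣≡length-filter f (g ∘ Fin.suc)

length-elements : ∀ {k} (p : Subset k) → length (elements p) ≡ ∣ p ∣
length-elements p = trans (sym (∣tabulate∣≡length-filter (lookup p) id)) (cong ∣_∣ (tabulate∘lookup p))

∈-elements⁺ : ∀ {k} {p : Subset k} {x} → x ∈ p → x ∈ˡ elements p
∈-elements⁺ {p = p} {x} x∈p = ∈-filter⁺ (T? ∘ lookup p) (∈-allFin x) (∈⇒T-lookup x∈p)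

∈-elements⁻ : ∀ {k} {p : Subset k} {x} → x ∈ˡ elements p → x ∈ p
∈-elements⁻ {k} {p} x∈ = T-lookup⇒∈ (proj₂ (∈-filter⁻ (T? ∘ lookup p) {xs = allFin k} x∈))

length-filter-replicate : ∀ {A : Set} (f : A → Bool) c x → length (filterᵇ f (replicate c x)) ≡ (if f x then c else 0)
length-filter-replicate f c x with f x in fx
... | true  = trans (cong length (filter-all (T? ∘ f) (All.replicate⁺ c (Equivalence.from T-≡ fx))))
                    (length-replicate c)
... | false = cong length (filter-none (T? ∘ f) (All.replicate⁺ c (subst Bool.T fx)))

sum-filter-∷ : ∀ {A : Set} (f : A → Bool) (w : A → ℕ) x xs →
               sum (map w (filterᵇ f (x ∷ xs))) ≡ (if f x then w x else 0) + sum (map w (filterᵇ f xs))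
sum-filter-∷ f w x xs with f x
... | true  = refl
... | false = refl

length-filter-replicates : ∀ {A : Set} (f : A → Bool) (w : A → ℕ) (xs : List A) →
                           length (filterᵇ f (concatMap (λ x → replicate (w x) x) xs)) ≡ sum (map w (filterᵇ f xs))
length-filter-replicates f w []       = refl
length-filter-replicates f w (x ∷ xs) = begin
  length (filterᵇ f (copies ++ rest))                    ≡⟨ cong length (filter-++ (T? ∘ f) copies rest) ⟩
  length (filterᵇ f copies ++ filterᵇ f rest)            ≡⟨ length-++ (filterᵇ f copies) ⟩
  length (filterᵇ f copies) + length (filterᵇ f rest)    ≡⟨ cong₂ _+_ (length-filter-replicate f (w x) x)
                                                                      (length-filter-replicates f w xs) ⟩
  (if f x then w x else 0) + sum (map w (filterᵇ f xs))  ≡⟨ sum-filter-∷ f w x xs ⟨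
  sum (map w (filterᵇ f (x ∷ xs)))                       ∎
  where
  open ≡-Reasoning
  copies = replicate (w x) x
  rest = concatMap (λ x → replicate (w x) x) xs

∈-⋃⁺ : ∀ {k} {X x} (Xs : List (Subset k)) → X ∈ˡ Xs → x ∈ X → x ∈ ⋃ Xs
∈-⋃⁺ (X ∷ Xs) (here refl) x∈X = p⊆p∪q (⋃ Xs) x∈X
∈-⋃⁺ (Y ∷ Xs) (there X∈)  x∈X = q⊆p∪q Y (⋃ Xs) (∈-⋃⁺ Xs X∈ x∈X)

∈-⋃⁻ : ∀ {k} {x} (Xs : List (Subset k)) → x ∈ ⋃ Xs → ∃ λ X → X ∈ˡ Xs × x ∈ X
∈-⋃⁻ []       x∈ = ⊥-elim (∉⊥ x∈)
∈-⋃⁻ (X ∷ Xs) x∈ with x∈p∪q⁻ X (⋃ Xs) x∈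
... | inj₁ x∈X = X , here refl , x∈X
... | inj₂ x∈⋃ with ∈-⋃⁻ Xs x∈⋃
...   | Y , Y∈ , x∈Y = Y , there Y∈ , x∈Y

antichain-≡ : ∀ {k} {L : List (Subset k)} → AllPairs (λ X Y → ¬ X ⊆ Y × ¬ Y ⊆ X) L →
              ∀ {X Y} → X ∈ˡ L → Y ∈ˡ L → X ⊆ Y ⊎ Y ⊆ X → X ≡ Y
antichain-≡ (_ ∷ _)          (here refl) (here refl) _ = refl
antichain-≡ (X#L ∷ _)        (here refl) (there Y∈) X⊆Y⊎Y⊆X =
  ⊥-elim ([ proj₁ (All.lookup X#L Y∈) , proj₂ (All.lookup X#L Y∈) ]′ X⊆Y⊎Y⊆X)
antichain-≡ (Y#L ∷ _)        (there X∈) (here refl) X⊆Y⊎Y⊆X =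
  ⊥-elim ([ proj₂ (All.lookup Y#L X∈) , proj₁ (All.lookup Y#L X∈) ]′ X⊆Y⊎Y⊆X)
antichain-≡ (_ ∷ antichain)  (there X∈) (there Y∈) X⊆Y⊎Y⊆X = antichain-≡ antichain X∈ Y∈ X⊆Y⊎Y⊆X

singletons-antichain : ∀ {k} (p : Subset k) → AllPairs (λ X Y → ¬ X ⊆ Y × ¬ Y ⊆ X) (map ⁅_⁆ (elements p))
singletons-antichain p = AllPairs.map⁺ (AllPairs.filter⁺ (T? ∘ lookup p) (AllPairs.tabulate⁺ {f = id} incomparable))
  where
  incomparable : ∀ {x y} → x ≢ y → ¬ ⁅ x ⁆ ⊆ ⁅ y ⁆ × ¬ ⁅ y ⁆ ⊆ ⁅ x ⁆
  incomparable {x} {y} x≢y = (λ ⊆ → x≢y (x∈⁅y⁆⇒x≡y y (⊆ (x∈⁅x⁆ x)))) , (λ ⊆ → x≢y (sym (x∈⁅y⁆⇒x≡y x (⊆ (x∈⁅x⁆ y)))))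

⋃-singletons : ∀ {k} (p : Subset k) → ⋃ (map ⁅_⁆ (elements p)) ≡ p
⋃-singletons p = ⊆-antisym ⊆p p⊆
  where
  ⊆p : ⋃ (map ⁅_⁆ (elements p)) ⊆ p
  ⊆p x∈ with ∈-⋃⁻ (map ⁅_⁆ (elements p)) x∈
  ... | X , X∈ , x∈X with ∈-map⁻ ⁅_⁆ X∈
  ...   | y , y∈ , refl rewrite x∈⁅y⁆⇒x≡y y x∈X = ∈-elements⁻ y∈
  p⊆ : p ⊆ ⋃ (map ⁅_⁆ (elements p))
  p⊆ {x} x∈p = ∈-⋃⁺ (map ⁅_⁆ (elements p)) (∈-map⁺ ⁅_⁆ (∈-elements⁺ x∈p)) (x∈⁅x⁆ x)

module _ {k : ℕ} where
  open import Data.Rational using (ℚ; 0ℚ) renaming (_+_ to _+ℚ_; _≤_ to _≤ℚ_)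
  import Data.Rational.Properties as ℚ

  open import Algebra.Properties.CommutativeSemigroup (CommutativeMonoid.commutativeSemigroup ℚ.+-0-commutativeMonoid)
    using () renaming (x∙yz≈y∙xz to +-exchange)

  Combination : Set
  Combination = List (ℚ × Subset k)

  NonNegative : Combination → Set
  NonNegative cs = All (0ℚ ≤ℚ_) (map proj₁ cs)

  coefficientAt : ℚ → Subset k → Fin k → ℚ
  coefficientAt c g j = if lookup g j then c else 0ℚ

  addAt : (ds : Combination) {g : Subset k} → g ∈ˡ map proj₂ ds → ℚ → Combination
  addAt ((d , h) ∷ ds) (here _)   c = (d +ℚ c , h) ∷ ds
  addAt (dh ∷ ds)      (there g∈) c = dh ∷ addAt ds g∈ c

  generators-addAt : ∀ ds {g} (g∈ : g ∈ˡ map proj₂ ds) c → map proj₂ (addAt ds g∈ c) ≡ map proj₂ ds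
  generators-addAt ((d , h) ∷ ds) (here _)   c = refl
  generators-addAt (dh ∷ ds)      (there g∈) c = cong (proj₂ dh ∷_) (generators-addAt ds g∈ c)

  nonNegative-addAt : ∀ ds {g} (g∈ : g ∈ˡ map proj₂ ds) {c} → NonNegative ds → 0ℚ ≤ℚ c →
                      NonNegative (addAt ds g∈ c)
  nonNegative-addAt ((d , h) ∷ ds) (here _)   (0≤d ∷ ds≥0) 0≤c = ℚ.+-mono-≤ 0≤d 0≤c ∷ ds≥0
  nonNegative-addAt (dh ∷ ds)      (there g∈) (0≤d ∷ ds≥0) 0≤c = 0≤d ∷ nonNegative-addAt ds g∈ ds≥0 0≤c

  lincomb-addAt : ∀ ds {g} (g∈ : g ∈ˡ map proj₂ ds) c j →
                  lincomb (addAt ds g∈ c) j ≡ coefficientAt c g j +ℚ lincomb ds j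
  lincomb-addAt ((d , h) ∷ ds) (here refl) c j with lookup h j
  ... | true  = trans (ℚ.+-assoc d c (lincomb ds j)) (+-exchange d c (lincomb ds j))
  ... | false = cong (0ℚ +ℚ_) (sym (ℚ.+-identityˡ (lincomb ds j)))
  lincomb-addAt ((d , h) ∷ ds) {g} (there g∈) c j =
    trans (cong (coefficientAt d h j +ℚ_) (lincomb-addAt ds g∈ c j))
          (+-exchange (coefficientAt d h j) (coefficientAt c g j) (lincomb ds j))

  zeroCombination : List (Subset k) → Combination
  zeroCombination = map (0ℚ ,_)

  generators-zeroCombination : ∀ gs → map proj₂ (zeroCombination gs) ≡ gs
  generators-zeroCombination []       = refl
  generators-zeroCombination (g ∷ gs) = cong (g ∷_) (generators-zeroCombination gs)

  nonNegative-zeroCombination : ∀ gs → NonNegative (zeroCombination gs)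
  nonNegative-zeroCombination []       = []
  nonNegative-zeroCombination (g ∷ gs) = ℚ.≤-refl ∷ nonNegative-zeroCombination gs

  lincomb-zeroCombination : ∀ gs j → lincomb (zeroCombination gs) j ≡ 0ℚ
  lincomb-zeroCombination []       j = refl
  lincomb-zeroCombination (g ∷ gs) j with lookup g j
  ... | true  = trans (ℚ.+-identityˡ _) (lincomb-zeroCombination gs j)
  ... | false = trans (ℚ.+-identityˡ _) (lincomb-zeroCombination gs j)

  -- Every coefficient of cs is moved onto one occurrence of its generator in gs.
  reindex : (gs : List (Subset k)) (cs : Combination) → NonNegative cs →
            (∀ {g} → g ∈ˡ map proj₂ cs → g ∈ˡ gs) →
            Σ Combination λ ds → map proj₂ ds ≡ gs × NonNegative ds × (∀ j → lincomb ds j ≡ lincomb cs j)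
  reindex gs [] _ _ =
    zeroCombination gs , generators-zeroCombination gs , nonNegative-zeroCombination gs , lincomb-zeroCombination gs
  reindex gs ((c , g) ∷ cs) (0≤c ∷ cs≥0) cs⊆gs with reindex gs cs cs≥0 (cs⊆gs ∘ there)
  ... | ds , refl , ds≥0 , ds≈cs =
    addAt ds g∈ c , generators-addAt ds g∈ c , nonNegative-addAt ds g∈ ds≥0 0≤c ,
    λ j → trans (lincomb-addAt ds g∈ c j) (cong (coefficientAt c g j +ℚ_) (ds≈cs j))
    where g∈ = cs⊆gs (here refl)

  InCone-mono : ∀ {gs₁ gs₂ : List (Subset k)} → (∀ {g} → g ∈ˡ gs₁ → g ∈ˡ gs₂) →
                ∀ x → InCone gs₁ x → InCone gs₂ x
  InCone-mono {gs₂ = gs₂} gs₁⊆gs₂ x (cs , refl , cs≥0 , a , x≈) with reindex gs₂ cs cs≥0 gs₁⊆gs₂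
  ... | ds , ds-gens , ds≥0 , ds≈cs =
    ds , ds-gens , ds≥0 , a , λ j → trans (x≈ j) (cong (_+ℚ a) (sym (ds≈cs j)))

  sameCone : ∀ {gs₁ gs₂ : List (Subset k)} → (∀ {g} → g ∈ˡ gs₁ → g ∈ˡ gs₂) → (∀ {g} → g ∈ˡ gs₂ → g ∈ˡ gs₁) →
             SameCone gs₁ gs₂
  sameCone gs₁⊆gs₂ gs₂⊆gs₁ x = InCone-mono gs₁⊆gs₂ x , InCone-mono gs₂⊆gs₁ x

module PolymatroidFlats {k : ℕ} (P : Polymatroid k) where
  open Polymatroid P

  rk-subadditive : ∀ A B → rk (A ∪ B) ≤ rk A + rk B
  rk-subadditive A B = ≤-trans (m≤m+n (rk (A ∪ B)) (rk (A ∩ B))) (submod A B)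

  rk-∪-singletons : ∀ A (l : List (Fin k)) → rk (A ∪ ⋃ (map ⁅_⁆ l)) ≤ rk A + sum (map (λ i → rk ⁅ i ⁆) l)
  rk-∪-singletons A []      = ≤-trans (≤-reflexive (cong rk (∪-identityʳ A))) (m≤m+n (rk A) 0)
  rk-∪-singletons A (i ∷ l) = begin
    rk (A ∪ (⁅ i ⁆ ∪ X))                   ≡⟨ cong rk (∪-assoc A ⁅ i ⁆ X) ⟨
    rk ((A ∪ ⁅ i ⁆) ∪ X)                   ≤⟨ rk-∪-singletons (A ∪ ⁅ i ⁆) l ⟩
    rk (A ∪ ⁅ i ⁆) + Σl                     ≤⟨ +-monoˡ-≤ Σl (rk-subadditive A ⁅ i ⁆) ⟩
    rk A + rk ⁅ i ⁆ + Σl                    ≡⟨ +-assoc (rk A) (rk ⁅ i ⁆) Σl ⟩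
    rk A + (rk ⁅ i ⁆ + Σl)                  ∎
    where
    open ≤-Reasoning
    X = ⋃ (map ⁅_⁆ l)
    Σl = sum (map (λ i → rk ⁅ i ⁆) l)

  rk-∪-redundant : ∀ A (l : List (Fin k)) → All (λ i → rk (A ∪ ⁅ i ⁆) ≡ rk A) l → rk (A ∪ ⋃ (map ⁅_⁆ l)) ≤ rk A
  rk-∪-redundant A []      []       = ≤-reflexive (cong rk (∪-identityʳ A))
  rk-∪-redundant A (i ∷ l) (i≈ ∷ l≈) = +-cancelʳ-≤ (rk A) _ _ (begin
    rk (A ∪ (⁅ i ⁆ ∪ X)) + rk A                              ≤⟨ +-mono-≤ (monotone _ _ ⊆∪∪) (monotone _ _ A⊆∩) ⟩
    rk ((A ∪ ⁅ i ⁆) ∪ (A ∪ X)) + rk ((A ∪ ⁅ i ⁆) ∩ (A ∪ X))  ≤⟨ submod (A ∪ ⁅ i ⁆) (A ∪ X) ⟩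
    rk (A ∪ ⁅ i ⁆) + rk (A ∪ X)                              ≤⟨ +-mono-≤ (≤-reflexive i≈) (rk-∪-redundant A l l≈) ⟩
    rk A + rk A                                               ∎)
    where
    open ≤-Reasoning
    X = ⋃ (map ⁅_⁆ l)
    A⊆∩ : A ⊆ (A ∪ ⁅ i ⁆) ∩ (A ∪ X)
    A⊆∩ = ∩-greatest (p⊆p∪q ⁅ i ⁆) (p⊆p∪q X)
    ⊆∪∪ : A ∪ (⁅ i ⁆ ∪ X) ⊆ (A ∪ ⁅ i ⁆) ∪ (A ∪ X)
    ⊆∪∪ = ∪-least (p⊆p∪q _ ∘ p⊆p∪q ⁅ i ⁆)
                  (∪-least (p⊆p∪q _ ∘ q⊆p∪q A ⁅ i ⁆) (q⊆p∪q _ _ ∘ q⊆p∪q A X))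

  ⊥-flat : IsFlat rk ⊥
  ⊥-flat G (_ , i , i∈G , _) rkG≡0 =
    <-irrefl refl (<-≤-trans (loopless i) (≤-trans (monotone ⁅ i ⁆ G (⁅x⁆⊆ i∈G)) (≤-reflexive (trans rkG≡0 rk-∅))))

  ⊥-bottom : IsBottomFlat rk ⊥
  ⊥-bottom = ⊥-flat , λ _ _ → ⊥⊆

  nonempty⇒¬bottom : ∀ {X} → Nonempty X → ¬ IsBottomFlat rk X
  nonempty⇒¬bottom (x , x∈X) (_ , X⊆) = ∉⊥ (X⊆ ⊥ ⊥-flat x∈X)

  atom-minimal : ∀ {X Y} → IsAtom rk X → IsFlat rk Y → Nonempty Y → Y ⊆ X → X ⊆ Y
  atom-minimal {X} {Y} (_ , _ , below-bottom) Y-flat Y≠∅ Y⊆X with X ⊆? Y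
  ... | yes X⊆Y = X⊆Y
  ... | no  X⊈Y = let x , x∈X , x∉Y = ⊈⇒∃ X⊈Y in
                  ⊥-elim (nonempty⇒¬bottom Y≠∅ (below-bottom Y Y-flat (Y⊆X , x , x∈X , x∉Y)))

  flat-absorb : ∀ {Z W} → IsFlat rk Z → rk (Z ∪ W) ≤ rk Z → W ⊆ Z
  flat-absorb {Z} {W} Z-flat rk≤ {x} x∈W with x ∈? Z
  ... | yes x∈Z = x∈Z
  ... | no  x∉Z = ⊥-elim (Z-flat (Z ∪ W) (p⊆p∪q W , x , q⊆p∪q Z W x∈W , x∉Z)
                                   (≤-antisym rk≤ (monotone Z (Z ∪ W) (p⊆p∪q W))))

  rk-flat-∪-⁅⁆ : ∀ {F i} → IsFlat rk F → i ∉ F → rk F < rk (F ∪ ⁅ i ⁆)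
  rk-flat-∪-⁅⁆ {F} {i} F-flat i∉F = ≤∧≢⇒< (monotone F (F ∪ ⁅ i ⁆) (p⊆p∪q ⁅ i ⁆))
    (λ rk≡ → F-flat (F ∪ ⁅ i ⁆) (p⊆p∪q ⁅ i ⁆ , i , q⊆p∪q F ⁅ i ⁆ (x∈⁅x⁆ i) , i∉F) (sym rk≡))

  isClosure-sameRank : ∀ {U V} → U ⊆ V → IsFlat rk V → rk V ≤ rk U → IsClosure rk U V
  isClosure-sameRank {U} {V} U⊆V V-flat rkV≤ = V-flat , U⊆V , λ Z Z-flat U⊆Z →
    flat-absorb Z-flat (+-cancelʳ-≤ (rk (Z ∩ V)) (rk (Z ∪ V)) (rk Z)
      (≤-trans (submod Z V) (+-monoʳ-≤ (rk Z) (≤-trans rkV≤ (monotone U (Z ∩ V) (∩-greatest U⊆Z U⊆V))))))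

  isClosure-flat : ∀ {U C} → IsFlat rk U → IsClosure rk U C → C ≡ U
  isClosure-flat {U} U-flat (_ , U⊆C , C-least) = ⊆-antisym (C-least U U-flat id) U⊆C

  cl : Subset k → Subset k
  cl A = tabulate λ i → ⌊ rk (A ∪ ⁅ i ⁆) ≟ rk A ⌋

  ∈-cl⁺ : ∀ {A i} → rk (A ∪ ⁅ i ⁆) ≡ rk A → i ∈ cl A
  ∈-cl⁺ rk≡ = ∈-tabulate⁺ (fromWitness rk≡)

  ∈-cl⁻ : ∀ {A i} → i ∈ cl A → rk (A ∪ ⁅ i ⁆) ≡ rk A
  ∈-cl⁻ i∈ = toWitness (∈-tabulate⁻ i∈)

  A⊆cl : ∀ A → A ⊆ cl A
  A⊆cl A {i} i∈A = ∈-cl⁺ (≤-antisym (monotone _ _ (∪-least id (⁅x⁆⊆ i∈A))) (monotone _ _ (p⊆p∪q ⁅ i ⁆)))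

  rk-cl : ∀ A → rk (cl A) ≡ rk A
  rk-cl A = ≤-antisym (begin
    rk (cl A)                                ≤⟨ monotone _ _ (q⊆p∪q A (cl A)) ⟩
    rk (A ∪ cl A)                            ≡⟨ cong (λ X → rk (A ∪ X)) (⋃-singletons (cl A)) ⟨
    rk (A ∪ ⋃ (map ⁅_⁆ (elements (cl A))))  ≤⟨ rk-∪-redundant A _ (All.tabulate (∈-cl⁻ ∘ ∈-elements⁻)) ⟩
    rk A                                     ∎)
    (monotone _ _ (A⊆cl A))
    where open ≤-Reasoning

  cl-flat : ∀ A → IsFlat rk (cl A)
  cl-flat A G (cl⊆G , i , i∈G , i∉cl) rkG≡ = i∉cl (∈-cl⁺ (≤-antisym rk≤ (monotone _ _ (p⊆p∪q ⁅ i ⁆))))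
    where
    rk≤ : rk (A ∪ ⁅ i ⁆) ≤ rk A
    rk≤ = begin
      rk (A ∪ ⁅ i ⁆)  ≤⟨ monotone _ _ (∪-least (cl⊆G ∘ A⊆cl A) (⁅x⁆⊆ i∈G)) ⟩
      rk G            ≡⟨ trans rkG≡ (rk-cl A) ⟩
      rk A            ∎
      where open ≤-Reasoning

module LiftedMatroid {n : ℕ} (P : Polymatroid n) where
  open Polymatroid P
  open Lift P
  open PolymatroidFlats P

  ∈-preimage⁺ : ∀ {A j} → π j ∈ A → j ∈ preimage A
  ∈-preimage⁺ = ∈-tabulate⁺ ∘ ∈⇒T-lookup

  ∈-preimage⁻ : ∀ {A j} → j ∈ preimage A → π j ∈ A
  ∈-preimage⁻ = T-lookup⇒∈ ∘ ∈-tabulate⁻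

  ∈-image⁺ : ∀ {T j} → j ∈ T → π j ∈ image T
  ∈-image⁺ {T} {j} j∈T =
    ∈-tabulate⁺ (any⁺ _ (Any.map (λ { refl → Equivalence.from T-∧ (∈⇒T-lookup j∈T , fromWitness refl) }) (∈-allFin j)))

  ∈-image⁻ : ∀ {T i} → i ∈ image T → ∃ λ j → j ∈ T × π j ≡ i
  ∈-image⁻ {T} i∈ with Any.satisfied (any⁻ _ (allFin m) (∈-tabulate⁻ i∈))
  ... | j , t with Equivalence.to T-∧ t
  ...   | j∈T , πj≡i = j , T-lookup⇒∈ j∈T , toWitness πj≡i

  image-⊆ : ∀ {T A} → T ⊆ preimage A → image T ⊆ A
  image-⊆ T⊆ i∈ with ∈-image⁻ i∈
  ... | j , j∈T , refl = ∈-preimage⁻ (T⊆ j∈T)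

  fibre : ∀ i → ∃ λ j → π j ≡ i
  fibre i = Any.index i∈πList , sym (lookup-index i∈πList)
    where
    ∈-replicate : ∀ c → 0 < c → i ∈ˡ replicate c i
    ∈-replicate (suc c) _ = here refl
    i∈πList : i ∈ˡ πList
    i∈πList = ∈-concatMap⁺ (λ i → replicate (rk ⁅ i ⁆) i)
                           (Any.map (λ { refl → ∈-replicate (rk ⁅ i ⁆) (loopless i) }) (∈-allFin i))

  preimage-mono : ∀ {A B} → A ⊆ B → preimage A ⊆ preimage B
  preimage-mono A⊆B = ∈-preimage⁺ ∘ A⊆B ∘ ∈-preimage⁻

  preimage-reflects-⊆ : ∀ {A B} → preimage A ⊆ preimage B → A ⊆ B
  preimage-reflects-⊆ pA⊆pB {i} i∈A with fibre i
  ... | j , refl = ∈-preimage⁻ (pA⊆pB (∈-preimage⁺ i∈A))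

  preimage-injective : ∀ {A B} → preimage A ≡ preimage B → A ≡ B
  preimage-injective eq = ⊆-antisym (preimage-reflects-⊆ (⊆-reflexive eq)) (preimage-reflects-⊆ (⊆-reflexive (sym eq)))

  preimage-nonempty : ∀ {A} → Nonempty A → Nonempty (preimage A)
  preimage-nonempty (i , i∈A) with fibre i
  ... | j , refl = j , ∈-preimage⁺ i∈A

  preimage-⊥ : preimage ⊥ ≡ ⊥
  preimage-⊥ = ⊆-antisym (⊥-elim ∘ ∉⊥ ∘ ∈-preimage⁻) ⊥⊆

  preimage-⊤ : preimage ⊤ ≡ ⊤
  preimage-⊤ = ⊆-antisym ⊆⊤ (λ _ → ∈-preimage⁺ ∈⊤)

  preimage-∪ : ∀ A B → preimage (A ∪ B) ≡ preimage A ∪ preimage B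
  preimage-∪ A B = ⊆-antisym
    (λ j∈ → [ p⊆p∪q (preimage B) ∘ ∈-preimage⁺ , q⊆p∪q (preimage A) (preimage B) ∘ ∈-preimage⁺ ]′
              (x∈p∪q⁻ A B (∈-preimage⁻ {A ∪ B} j∈)))
    (∪-least (preimage-mono {A} (p⊆p∪q B)) (preimage-mono (q⊆p∪q A B)))

  preimage-─ : ∀ A B → preimage (A ─ B) ≡ preimage A ─ preimage B
  preimage-─ A B = ⊆-antisym
    (λ j∈ → let πj∈A , πj∉B = x∈p─q⁻ A B (∈-preimage⁻ j∈)
            in x∈p∧x∉q⇒x∈p─q (∈-preimage⁺ πj∈A) (πj∉B ∘ ∈-preimage⁻ {B}))
    (λ j∈ → let j∈A , j∉B = x∈p─q⁻ (preimage A) (preimage B) j∈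
            in ∈-preimage⁺ {A ─ B} (x∈p∧x∉q⇒x∈p─q (∈-preimage⁻ {A} j∈A) (j∉B ∘ ∈-preimage⁺)))

  ∣preimage∣ : ∀ A → ∣ preimage A ∣ ≡ sum (map (λ i → rk ⁅ i ⁆) (elements A))
  ∣preimage∣ A = begin
    ∣ tabulate (lookup A ∘ π) ∣                        ≡⟨ ∣tabulate∣≡length-filter (lookup A) π ⟩
    length (filterᵇ (lookup A) (List.tabulate π))      ≡⟨ cong (length ∘ filterᵇ (lookup A)) (tabulate-lookup πList) ⟩
    length (filterᵇ (lookup A) πList)                  ≡⟨ length-filter-replicates (lookup A) (rk ∘ ⁅_⁆) (allFin n) ⟩
    sum (map (λ i → rk ⁅ i ⁆) (elements A))            ∎
    where open ≡-Reasoning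

  rk-∪≤rk+∣new-fibres∣ : ∀ A X → rk (A ∪ X) ≤ rk A + ∣ preimage X ─ preimage A ∣
  rk-∪≤rk+∣new-fibres∣ A X = begin
    rk (A ∪ X)                                    ≤⟨ monotone _ _ (∪-least (p⊆p∪q (X ─ A)) (p⊆q∪[p─q] X A)) ⟩
    rk (A ∪ (X ─ A))                              ≡⟨ cong (λ Y → rk (A ∪ Y)) (⋃-singletons (X ─ A)) ⟨
    rk (A ∪ ⋃ (map ⁅_⁆ (elements (X ─ A))))      ≤⟨ rk-∪-singletons A (elements (X ─ A)) ⟩
    rk A + sum (map (λ i → rk ⁅ i ⁆) (elements (X ─ A)))  ≡⟨ cong (rk A +_) (∣preimage∣ (X ─ A)) ⟨
    rk A + ∣ preimage (X ─ A) ∣                   ≡⟨ cong (λ Y → rk A + ∣ Y ∣) (preimage-─ X A) ⟩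
    rk A + ∣ preimage X ─ preimage A ∣            ∎
    where open ≤-Reasoning

  rk≤∣preimage∣ : ∀ X → rk X ≤ ∣ preimage X ∣
  rk≤∣preimage∣ X = begin
    rk X                                  ≤⟨ monotone _ _ (q⊆p∪q ⊥ X) ⟩
    rk (⊥ ∪ X)                            ≤⟨ rk-∪≤rk+∣new-fibres∣ ⊥ X ⟩
    rk ⊥ + ∣ preimage X ─ preimage ⊥ ∣   ≡⟨ cong (_+ ∣ preimage X ─ preimage ⊥ ∣) rk-∅ ⟩
    ∣ preimage X ─ preimage ⊥ ∣           ≤⟨ ∣p─q∣≤∣p∣ (preimage X) (preimage ⊥) ⟩
    ∣ preimage X ∣                        ∎
    where open ≤-Reasoning

  cost : Subset m → Subset n → ℕ
  cost S A = rk A + ∣ S ─ preimage A ∣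

  cost-⊥ : ∀ S → cost S ⊥ ≡ rk ⊥ + ∣ S ∣
  cost-⊥ S = cong (λ X → rk ⊥ + ∣ X ∣) (trans (cong (S ─_) preimage-⊥) (p─⊥≡p S))

  rkT≤cost : ∀ S A → rkT S ≤ cost S A
  rkT≤cost S A = foldr-preservesᵒ {P = _≤ cost S A} (λ x y → [ ≤-trans (m⊓n≤m x y) , ≤-trans (m⊓n≤n x y) ]′) _ _
                   (inj₂ (Any.map (≤-reflexive ∘ sym) (∈-map⁺ (cost S) (∈-allSubsets A))))

  ≤rkT : ∀ S {c} → (∀ A → c ≤ cost S A) → c ≤ rkT S
  ≤rkT S {c} c≤ = foldr-preservesᵇ {P = c ≤_} ⊓-glb (subst (c ≤_) (cost-⊥ S) (c≤ ⊥))
                                   (All.map⁺ {xs = allSubsets n} (All.tabulate λ {A} _ → c≤ A))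

  rkT-attained : ∀ S → ∃ λ A → rkT S ≡ cost S A
  rkT-attained S = foldr-preservesᵇ {P = λ x → ∃ λ A → x ≡ cost S A} select (⊥ , sym (cost-⊥ S))
                                    (All.map⁺ {xs = allSubsets n} (All.tabulate λ {A} _ → A , refl))
    where
    select : ∀ {x y} → (∃ λ A → x ≡ cost S A) → (∃ λ A → y ≡ cost S A) → ∃ λ A → x ⊓ y ≡ cost S A
    select {x} {y} (A , x≡) (B , y≡) = [ (λ e → A , trans e x≡) , (λ e → B , trans e y≡) ]′ (⊓-sel x y)

  cost-mono : ∀ {S S′} A → S ⊆ S′ → cost S A ≤ cost S′ A
  cost-mono A S⊆S′ = +-monoʳ-≤ (rk A) (p⊆q⇒∣p∣≤∣q∣ (─-monoˡ (preimage A) S⊆S′))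

  rkT-mono : ∀ S S′ → S ⊆ S′ → rkT S ≤ rkT S′
  rkT-mono S S′ S⊆S′ = ≤rkT S′ λ A → ≤-trans (rkT≤cost S A) (cost-mono A S⊆S′)

  rkT-submod : ∀ S S′ → rkT (S ∪ S′) + rkT (S ∩ S′) ≤ rkT S + rkT S′
  rkT-submod S S′ with rkT-attained S | rkT-attained S′
  ... | A , rkT≡ | A′ , rkT′≡ = begin
    rkT (S ∪ S′) + rkT (S ∩ S′)                        ≤⟨ +-mono-≤ (rkT≤cost (S ∪ S′) (A ∪ A′))
                                                                   (rkT≤cost (S ∩ S′) (A ∩ A′)) ⟩
    (rk (A ∪ A′) + ∣ X ∣) + (rk (A ∩ A′) + ∣ Y ∣)      ≡⟨ +-interchange (rk (A ∪ A′)) (∣ X ∣) (rk (A ∩ A′)) (∣ Y ∣) ⟩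
    (rk (A ∪ A′) + rk (A ∩ A′)) + (∣ X ∣ + ∣ Y ∣)      ≤⟨ +-mono-≤ (submod A A′) (∣─∣-submodular S S′ ∪⊆ ∩⊆) ⟩
    (rk A + rk A′) + (∣ Z ∣ + ∣ Z′ ∣)                   ≡⟨ +-interchange (rk A) (rk A′) (∣ Z ∣) (∣ Z′ ∣) ⟩
    cost S A + cost S′ A′                              ≡⟨ cong₂ _+_ rkT≡ rkT′≡ ⟨
    rkT S + rkT S′                                     ∎
    where
    open ≤-Reasoning
    X = (S ∪ S′) ─ preimage (A ∪ A′)
    Y = (S ∩ S′) ─ preimage (A ∩ A′)
    Z = S ─ preimage A
    Z′ = S′ ─ preimage A′
    ∪⊆ : preimage A ∪ preimage A′ ⊆ preimage (A ∪ A′)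
    ∪⊆ = ⊆-reflexive (sym (preimage-∪ A A′))
    ∩⊆ : preimage A ∩ preimage A′ ⊆ preimage (A ∩ A′)
    ∩⊆ j∈ = let j∈A , j∈A′ = x∈p∩q⁻ _ _ j∈ in
            ∈-preimage⁺ {A ∩ A′} (x∈p∩q⁺ (∈-preimage⁻ {A} j∈A , ∈-preimage⁻ {A′} j∈A′))

  rkT-preimage : ∀ A → rkT (preimage A) ≡ rk A
  rkT-preimage A = ≤-antisym
    (≤-trans (rkT≤cost (preimage A) A)
             (≤-reflexive (trans (cong (rk A +_) (∣p─p∣≡0 (preimage A))) (+-identityʳ (rk A)))))
    (≤rkT (preimage A) λ B → ≤-trans (monotone _ _ (q⊆p∪q B A)) (rk-∪≤rk+∣new-fibres∣ B A))

  rkT-∅ : rkT ⊥ ≡ 0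
  rkT-∅ = trans (cong rkT (sym preimage-⊥)) (trans (rkT-preimage ⊥) rk-∅)

  rkT-loopless : ∀ j → 0 < rkT ⁅ j ⁆
  rkT-loopless j = ≤rkT ⁅ j ⁆ λ A → case j ∈? preimage A of λ where
    (yes j∈A) → ≤-trans (loopless (π j)) (≤-trans (monotone _ _ (⁅x⁆⊆ (∈-preimage⁻ j∈A))) (m≤m+n (rk A) _))
    (no  j∉A) → ≤-trans (∣p∣>0 (j , x∈p∧x∉q⇒x∈p─q (x∈⁅x⁆ j) j∉A)) (m≤n+m _ (rk A))

  P̃ : Polymatroid m
  P̃ = record
    { rk = rkT ; rk-∅ = rkT-∅ ; monotone = rkT-mono ; submod = rkT-submod ; loopless = rkT-loopless }

  module F̃ = PolymatroidFlats P̃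

  ¬preimage⁅⁆⊆⁅⁆ : ∀ j → 2 ≤ rk ⁅ π j ⁆ → ¬ preimage ⁅ π j ⁆ ⊆ ⁅ j ⁆
  ¬preimage⁅⁆⊆⁅⁆ j 2≤rk p⊆⁅j⁆ = <-irrefl refl (<-≤-trans 2≤rk (begin
    rk ⁅ π j ⁆               ≤⟨ rk≤∣preimage∣ ⁅ π j ⁆ ⟩
    ∣ preimage ⁅ π j ⁆ ∣     ≤⟨ p⊆q⇒∣p∣≤∣q∣ p⊆⁅j⁆ ⟩
    ∣ ⁅ j ⁆ ∣                ≡⟨ ∣⁅x⁆∣≡1 j ⟩
    1                        ∎))
    where open ≤-Reasoning

  Free : Subset n → Subset m → Set
  Free F T = ∀ T₀ → Nonempty T₀ → T₀ ⊆ T → rk F + ∣ T₀ ∣ < rk (F ∪ image T₀)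

  module FreeExtension {F : Subset n} (F-flat : IsFlat rk F) {T : Subset m}
                       (T∩F=∅ : ∀ {j} → j ∈ T → j ∉ preimage F) (T-free : Free F T) where

    U : Subset m
    U = preimage F ∪ T

    rk-∪-image : ∀ {T₀} → T₀ ⊆ T → rk F + ∣ T₀ ∣ ≤ rk (F ∪ image T₀)
    rk-∪-image {T₀} T₀⊆T with nonempty? T₀
    ... | yes T₀≠∅ = <⇒≤ (T-free T₀ T₀≠∅ T₀⊆T)
    ... | no  ∄    = begin
      rk F + ∣ T₀ ∣          ≡⟨ trans (cong (rk F +_) (Empty⇒∣p∣≡0 ∄)) (+-identityʳ (rk F)) ⟩
      rk F                   ≤⟨ monotone _ _ (p⊆p∪q (image T₀)) ⟩
      rk (F ∪ image T₀)      ∎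
      where open ≤-Reasoning

    rk-∪-image-∪⁅⁆ : ∀ {T₀} → T₀ ⊆ T → ∀ {i} → i ∉ F → rk F + ∣ T₀ ∣ < rk ((F ∪ image T₀) ∪ ⁅ i ⁆)
    rk-∪-image-∪⁅⁆ {T₀} T₀⊆T {i} i∉F with nonempty? T₀
    ... | yes T₀≠∅ = <-≤-trans (T-free T₀ T₀≠∅ T₀⊆T) (monotone _ _ (p⊆p∪q ⁅ i ⁆))
    ... | no  ∄    = begin-strict
      rk F + ∣ T₀ ∣                ≡⟨ trans (cong (rk F +_) (Empty⇒∣p∣≡0 ∄)) (+-identityʳ (rk F)) ⟩
      rk F                         <⟨ rk-flat-∪-⁅⁆ F-flat i∉F ⟩
      rk (F ∪ ⁅ i ⁆)               ≤⟨ monotone _ _ (∪-least (p⊆p∪q ⁅ i ⁆ ∘ p⊆p∪q (image T₀)) (q⊆p∪q _ ⁅ i ⁆)) ⟩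
      rk ((F ∪ image T₀) ∪ ⁅ i ⁆)  ∎
      where open ≤-Reasoning

    F∪image⊆ : ∀ A → F ∪ image (T ∩ preimage A) ⊆ A ∪ F
    F∪image⊆ A = ∪-least (q⊆p∪q A F) (p⊆p∪q F ∘ image-⊆ (p∩q⊆q T (preimage A)))

    rk+∣T∩A∣≤ : ∀ A → rk F + ∣ T ∩ preimage A ∣ ≤ rk A + ∣ preimage F ─ preimage A ∣
    rk+∣T∩A∣≤ A = begin
      rk F + ∣ T ∩ preimage A ∣              ≤⟨ rk-∪-image (p∩q⊆p T (preimage A)) ⟩
      rk (F ∪ image (T ∩ preimage A))        ≤⟨ monotone _ _ (F∪image⊆ A) ⟩
      rk (A ∪ F)                             ≤⟨ rk-∪≤rk+∣new-fibres∣ A F ⟩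
      rk A + ∣ preimage F ─ preimage A ∣     ∎
      where open ≤-Reasoning

    rk+∣T∩A∣< : ∀ A {i} → i ∈ A → i ∉ F → rk F + ∣ T ∩ preimage A ∣ < rk A + ∣ preimage F ─ preimage A ∣
    rk+∣T∩A∣< A {i} i∈A i∉F = begin-strict
      rk F + ∣ T ∩ preimage A ∣                  <⟨ rk-∪-image-∪⁅⁆ (p∩q⊆p T (preimage A)) i∉F ⟩
      rk ((F ∪ image (T ∩ preimage A)) ∪ ⁅ i ⁆)  ≤⟨ monotone _ _ (∪-least (F∪image⊆ A) (p⊆p∪q F ∘ ⁅x⁆⊆ i∈A)) ⟩
      rk (A ∪ F)                                 ≤⟨ rk-∪≤rk+∣new-fibres∣ A F ⟩
      rk A + ∣ preimage F ─ preimage A ∣         ∎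
      where open ≤-Reasoning

    split-rank : ∀ A → rk F + ∣ T ∣ ≡ (rk F + ∣ T ∩ preimage A ∣) + ∣ T ─ preimage A ∣
    split-rank A = trans (cong (rk F +_) (∣p∣≡∣p∩q∣+∣p─q∣ T (preimage A))) (sym (+-assoc (rk F) _ _))

    split-cost : ∀ A → cost U A ≡ (rk A + ∣ preimage F ─ preimage A ∣) + ∣ T ─ preimage A ∣
    split-cost A = begin
      rk A + ∣ U ─ pA ∣                    ≡⟨ cong (λ X → rk A + ∣ X ∣) ([p∪q]─r≡[p─r]∪[q─r] pF T pA) ⟩
      rk A + ∣ (pF ─ pA) ∪ (T ─ pA) ∣      ≡⟨ cong (rk A +_) (∣p∪q∣≡∣p∣+∣q∣ (pF ─ pA) (T ─ pA) disjoint) ⟩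
      rk A + (∣ pF ─ pA ∣ + ∣ T ─ pA ∣)    ≡⟨ +-assoc (rk A) _ _ ⟨
      (rk A + ∣ pF ─ pA ∣) + ∣ T ─ pA ∣    ∎
      where
      open ≡-Reasoning
      pF = preimage F
      pA = preimage A
      disjoint : Empty ((pF ─ pA) ∩ (T ─ pA))
      disjoint (j , j∈) = let j∈F , j∈T = x∈p∩q⁻ _ _ j∈ in T∩F=∅ (proj₁ (x∈p─q⁻ T pA j∈T)) (proj₁ (x∈p─q⁻ pF pA j∈F))

    cost-U≥ : ∀ A → rk F + ∣ T ∣ ≤ cost U A
    cost-U≥ A = subst₂ _≤_ (sym (split-rank A)) (sym (split-cost A)) (+-monoˡ-≤ _ (rk+∣T∩A∣≤ A))

    cost-U> : ∀ A {i} → i ∈ A → i ∉ F → rk F + ∣ T ∣ < cost U A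
    cost-U> A i∈A i∉F = subst₂ _<_ (sym (split-rank A)) (sym (split-cost A)) (+-monoˡ-< _ (rk+∣T∩A∣< A i∈A i∉F))

    rkT-U : rkT U ≡ rk F + ∣ T ∣
    rkT-U = ≤-antisym
      (≤-trans (rkT≤cost U F) (≤-reflexive (cong (λ X → rk F + ∣ X ∣) ([p∪q]─p≡q (preimage F) T T∩F=∅))))
      (≤rkT U cost-U≥)

    U-flat : IsFlat rkT U
    U-flat G (U⊆G , j , j∈G , j∉U) rkTG≡ = <-irrefl refl (begin-strict
      rk F + ∣ T ∣               <⟨ ≤rkT (U ∪ ⁅ j ⁆) cost-U∪⁅j⁆> ⟩
      rkT (U ∪ ⁅ j ⁆)            ≤⟨ rkT-mono _ _ (∪-least U⊆G (⁅x⁆⊆ j∈G)) ⟩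
      rkT G                      ≡⟨ trans rkTG≡ rkT-U ⟩
      rk F + ∣ T ∣               ∎)
      where
      open ≤-Reasoning
      πj∉F : π j ∉ F
      πj∉F = j∉U ∘ p⊆p∪q T ∘ ∈-preimage⁺
      cost-U∪⁅j⁆> : ∀ A → rk F + ∣ T ∣ < cost (U ∪ ⁅ j ⁆) A
      cost-U∪⁅j⁆> A with π j ∈? A
      ... | yes πj∈A = <-≤-trans (cost-U> A πj∈A πj∉F) (cost-mono {U} A (p⊆p∪q ⁅ j ⁆))
      ... | no  πj∉A = ≤-<-trans (cost-U≥ A) (+-monoʳ-< (rk A) (p⊂q⇒∣p∣<∣q∣
              (─-monoˡ {p = U} (preimage A) (p⊆p∪q ⁅ j ⁆) , j ,
               x∈p∧x∉q⇒x∈p─q (q⊆p∪q U ⁅ j ⁆ (x∈⁅x⁆ j)) (πj∉A ∘ ∈-preimage⁻) , j∉U ∘ proj₁ ∘ x∈p─q⁻ U _)))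

  Free-mono : ∀ {F T T′} → T ⊆ T′ → Free F T′ → Free F T
  Free-mono T⊆T′ T′-free T₀ T₀≠∅ T₀⊆T = T′-free T₀ T₀≠∅ (T⊆T′ ∘ T₀⊆T)

  Free-⊥⇒2≤rk : ∀ {T j} → Free ⊥ T → j ∈ T → 2 ≤ rk ⁅ π j ⁆
  Free-⊥⇒2≤rk {T} {j} T-free j∈T = begin
    2                        ≡⟨ cong suc (cong₂ _+_ rk-∅ (∣⁅x⁆∣≡1 j)) ⟨
    suc (rk ⊥ + ∣ ⁅ j ⁆ ∣)    ≤⟨ T-free ⁅ j ⁆ (j , x∈⁅x⁆ j) (⁅x⁆⊆ j∈T) ⟩
    rk (⊥ ∪ image ⁅ j ⁆)      ≤⟨ monotone _ _ (∪-least ⊥⊆ (image-⊆ (⁅x⁆⊆ (∈-preimage⁺ (x∈⁅x⁆ (π j)))))) ⟩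
    rk ⁅ π j ⁆                ∎
    where open ≤-Reasoning

  Free-⊥-⁅⁆ : ∀ j → 2 ≤ rk ⁅ π j ⁆ → Free ⊥ ⁅ j ⁆
  Free-⊥-⁅⁆ j 2≤rk T₀ (x , x∈T₀) T₀⊆⁅j⁆ = begin-strict
    rk ⊥ + ∣ T₀ ∣         ≡⟨ cong (_+ ∣ T₀ ∣) rk-∅ ⟩
    ∣ T₀ ∣                ≤⟨ p⊆q⇒∣p∣≤∣q∣ T₀⊆⁅j⁆ ⟩
    ∣ ⁅ j ⁆ ∣             ≡⟨ ∣⁅x⁆∣≡1 j ⟩
    1                     <⟨ 2≤rk ⟩
    rk ⁅ π j ⁆            ≤⟨ monotone _ _ (⁅x⁆⊆ (q⊆p∪q ⊥ (image T₀) (∈-image⁺ x∈T₀′))) ⟩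
    rk (⊥ ∪ image T₀)     ∎
    where
    open ≤-Reasoning
    x∈T₀′ : j ∈ T₀
    x∈T₀′ = subst (_∈ T₀) (x∈⁅y⁆⇒x≡y j (T₀⊆⁅j⁆ x∈T₀)) x∈T₀

  ∉preimage-⊥ : ∀ {j} → j ∉ preimage ⊥
  ∉preimage-⊥ = ∉⊥ ∘ ∈-preimage⁻

  preimage-flat : ∀ {F} → IsFlat rk F → IsFlat rkT (preimage F)
  preimage-flat {F} F-flat = subst (IsFlat rkT) (∪-identityʳ (preimage F))
    (FreeExtension.U-flat F-flat (λ j∈⊥ → ⊥-elim (∉⊥ j∈⊥)) λ T₀ (j , j∈T₀) T₀⊆⊥ → ⊥-elim (∉⊥ (T₀⊆⊥ j∈T₀)))

  singleton-flat : ∀ j → 2 ≤ rk ⁅ π j ⁆ → IsFlat rkT ⁅ j ⁆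
  singleton-flat j 2≤rk = subst (IsFlat rkT) (trans (cong (_∪ ⁅ j ⁆) preimage-⊥) (∪-identityˡ ⁅ j ⁆))
    (FreeExtension.U-flat ⊥-flat (λ _ → ∉preimage-⊥) (Free-⊥-⁅⁆ j 2≤rk))

  singleton-atom : ∀ j → 2 ≤ rk ⁅ π j ⁆ → IsAtom rkT ⁅ j ⁆
  singleton-atom j 2≤rk = singleton-flat j 2≤rk , F̃.nonempty⇒¬bottom (j , x∈⁅x⁆ j) , below-bottom
    where
    below-bottom : ∀ G → IsFlat rkT G → G ⊂ ⁅ j ⁆ → IsBottomFlat rkT G
    below-bottom G _ (G⊆⁅j⁆ , x , x∈⁅j⁆ , x∉G) = subst (IsBottomFlat rkT) (sym (Empty-unique G-empty)) F̃.⊥-bottom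
      where
      G-empty : Empty G
      G-empty (y , y∈G) = x∉G (subst (_∈ G) (trans (x∈⁅y⁆⇒x≡y j (G⊆⁅j⁆ y∈G)) (sym (x∈⁅y⁆⇒x≡y j x∈⁅j⁆))) y∈G)

  -- Every fibre meeting a free extension T of F would have to lie in T, and a whole fibre is never free.
  free-extension-¬preimage : ∀ {F T G} → (∀ {j} → j ∈ T → j ∉ preimage F) → Free F T → Nonempty T →
                             preimage F ∪ T ≢ preimage G
  free-extension-¬preimage {F} {T} {G} T∩F=∅ T-free (j , j∈T) U≡pG = <-irrefl refl (begin-strict
    rk F + ∣ fibre-j ∣                          <⟨ T-free fibre-j (j , ∈-preimage⁺ (x∈⁅x⁆ (π j))) fibre-j⊆T ⟩
    rk (F ∪ image fibre-j)                      ≤⟨ monotone _ _ (∪-least (p⊆p∪q ⁅ π j ⁆) (q⊆p∪q F _ ∘ image-⊆ id)) ⟩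
    rk (F ∪ ⁅ π j ⁆)                            ≤⟨ rk-∪≤rk+∣new-fibres∣ F ⁅ π j ⁆ ⟩
    rk F + ∣ fibre-j ─ preimage F ∣             ≤⟨ +-monoʳ-≤ (rk F) (∣p─q∣≤∣p∣ fibre-j (preimage F)) ⟩
    rk F + ∣ fibre-j ∣                          ∎)
    where
    open ≤-Reasoning
    fibre-j = preimage ⁅ π j ⁆
    πj∈G : π j ∈ G
    πj∈G = ∈-preimage⁻ (subst (j ∈_) U≡pG (q⊆p∪q (preimage F) T j∈T))
    fibre-j⊆T : fibre-j ⊆ T
    fibre-j⊆T {x} x∈ with x∈p∪q⁻ (preimage F) T (subst (x ∈_) (sym U≡pG) (∈-preimage⁺ πx∈G))
      where πx∈G = subst (_∈ G) (sym (x∈⁅y⁆⇒x≡y (π j) (∈-preimage⁻ x∈))) πj∈G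
    ... | inj₂ x∈T = x∈T
    ... | inj₁ x∈F =
      ⊥-elim (T∩F=∅ j∈T (∈-preimage⁺ (subst (_∈ F) (x∈⁅y⁆⇒x≡y (π j) (∈-preimage⁻ x∈)) (∈-preimage⁻ x∈F))))

  rkT-∪≥ : ∀ {F T x} → IsFlat rk F → (∀ {j} → j ∈ T → j ∉ preimage F) → x ∈ T → Free F (T ─ ⁅ x ⁆) →
           rk F + ∣ T ∣ ≤ rkT (preimage F ∪ T)
  rkT-∪≥ {F} {T} {x} F-flat T∩F=∅ x∈T T′-free = begin
    rk F + ∣ T ∣           ≡⟨ trans (cong (rk F +_) (∣p∣≡1+∣p-x∣ x∈T)) (+-suc (rk F) ∣ T′ ∣) ⟩
    suc (rk F + ∣ T′ ∣)    ≡⟨ cong suc Ext.rkT-U ⟨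
    suc (rkT U′)           ≤⟨ F̃.rk-flat-∪-⁅⁆ Ext.U-flat x∉U′ ⟩
    rkT (U′ ∪ ⁅ x ⁆)        ≡⟨ cong rkT U≡ ⟨
    rkT (preimage F ∪ T)   ∎
    where
    open ≤-Reasoning
    T′ = T ─ ⁅ x ⁆
    U′ = preimage F ∪ T′
    module Ext = FreeExtension F-flat (T∩F=∅ ∘ p─q⊆p T ⁅ x ⁆) T′-free
    x∉U′ : x ∉ U′
    x∉U′ x∈U′ = [ T∩F=∅ x∈T , (λ x∈T′ → proj₂ (x∈p─q⁻ T ⁅ x ⁆ x∈T′) (x∈⁅x⁆ x)) ]′ (x∈p∪q⁻ (preimage F) T′ x∈U′)
    U≡ : preimage F ∪ T ≡ U′ ∪ ⁅ x ⁆
    U≡ = ⊆-antisym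
      (∪-least (p⊆p∪q ⁅ x ⁆ ∘ p⊆p∪q T′)
               (∪-least (q⊆p∪q U′ ⁅ x ⁆) (p⊆p∪q ⁅ x ⁆ ∘ q⊆p∪q (preimage F) T′) ∘ p⊆q∪[p─q] T ⁅ x ⁆))
      (∪-least (∪-least (p⊆p∪q T) (q⊆p∪q (preimage F) T ∘ p─q⊆p T ⁅ x ⁆)) (q⊆p∪q (preimage F) T ∘ ⁅x⁆⊆ x∈T))

  isClosure-preimage-cl : ∀ {F T} → rk (F ∪ image T) ≤ rkT (preimage F ∪ T) →
                          IsClosure rkT (preimage F ∪ T) (preimage (cl (F ∪ image T)))
  isClosure-preimage-cl {F} {T} rk≤ = F̃.isClosure-sameRank
    (∪-least (preimage-mono {F} (A⊆cl _ ∘ p⊆p∪q (image T))) (∈-preimage⁺ {H} ∘ A⊆cl _ ∘ q⊆p∪q F _ ∘ ∈-image⁺))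
    (preimage-flat (cl-flat _))
    (≤-trans (≤-reflexive (trans (rkT-preimage H) (rk-cl _))) rk≤)
    where H = cl (F ∪ image T)

  chain-top : ∀ {F Fs} → StrictChainFrom F Fs → F ⊂ ⊤
  chain-top (end F⊂⊤)         = F⊂⊤
  chain-top (step _ F⊂G chain) = ⊂-trans F⊂G (chain-top chain)

  chain-member : ∀ {F Fs G} → StrictChainFrom F Fs → G ∈ˡ Fs → IsFlat rk G × F ⊂ G × G ⊂ ⊤
  chain-member (step G-flat F⊂G chain) (here refl) = G-flat , F⊂G , chain-top chain
  chain-member (step _ F⊂G chain)      (there G∈)  = let G-flat , F′⊂G , G⊂⊤ = chain-member chain G∈ in
                                                     G-flat , ⊂-trans F⊂G F′⊂G , G⊂⊤

  chain-comparable : ∀ {F Fs G G′} → StrictChainFrom F Fs → G ∈ˡ Fs → G′ ∈ˡ Fs → G ⊆ G′ ⊎ G′ ⊆ G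
  chain-comparable (step _ _ chain) (here refl) (here refl) = inj₁ id
  chain-comparable (step _ _ chain) (here refl) (there G′∈) = inj₁ (p⊂q⇒p⊆q (proj₁ (proj₂ (chain-member chain G′∈))))
  chain-comparable (step _ _ chain) (there G∈)  (here refl) = inj₂ (p⊂q⇒p⊆q (proj₁ (proj₂ (chain-member chain G∈))))
  chain-comparable (step _ _ chain) (there G∈)  (there G′∈) = chain-comparable chain G∈ G′∈

  flag-flat : ∀ {Fs F} → IsFlagOfFlats Fs → F ∈ˡ (⊥ ∷ Fs) → IsFlat rk F
  flag-flat (⊥-flat , _)     (here refl) = ⊥-flat
  flag-flat (_      , chain) (there F∈)  = proj₁ (chain-member chain F∈)

  ∈-gensΣP⁻ : ∀ {Fs S X} → X ∈ˡ gensΣP Fs S → (∃ λ G → G ∈ˡ Fs × X ≡ preimage G) ⊎ (∃ λ j → j ∈ S × X ≡ ⁅ j ⁆)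
  ∈-gensΣP⁻ {Fs} X∈ with ∈-++⁻ (map preimage Fs) X∈
  ... | inj₁ X∈pFs = let G , G∈ , X≡ = ∈-map⁻ preimage X∈pFs in inj₁ (G , G∈ , X≡)
  ... | inj₂ X∈⁅S⁆ = let j , j∈ , X≡ = ∈-map⁻ ⁅_⁆ X∈⁅S⁆ in inj₂ (j , ∈-elements⁻ j∈ , X≡)

  Kind : Subset m → Set
  Kind X = (∃ λ G → InG G × X ≡ preimage G) ⊎ (∃ λ j → 2 ≤ rk ⁅ π j ⁆ × X ≡ ⁅ j ⁆)

  atom-kind : ∀ {X} → IsAtom rkT X → Kind X
  atom-kind {X} atom@(X-flat , ¬bottom , _) with nonempty? X
  ... | no  ∄ = ⊥-elim (¬bottom (subst (IsBottomFlat rkT) (sym (Empty-unique ∄)) F̃.⊥-bottom))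
  ... | yes (j , j∈X) with 2 ≤? rk ⁅ π j ⁆
  ...   | yes 2≤rk = inj₂ (j , 2≤rk ,
                           ⊆-antisym (F̃.atom-minimal atom (singleton-flat j 2≤rk) (j , x∈⁅x⁆ j) (⁅x⁆⊆ j∈X)) (⁅x⁆⊆ j∈X))
  ...   | no  2≰rk = inj₁ (H , (cl-flat ⁅ π j ⁆ , π j , πj∈H) ,
                           ⊆-antisym (F̃.atom-minimal atom pH-flat (j , j∈pH) pH⊆X) pH⊆X)
    where
    H = cl ⁅ π j ⁆
    πj∈H = A⊆cl ⁅ π j ⁆ (x∈⁅x⁆ (π j))
    j∈pH = ∈-preimage⁺ {H} πj∈H
    pH-flat = preimage-flat (cl-flat ⁅ π j ⁆)
    rkT-pH≤ : rkT (preimage H) ≤ rkT ⁅ j ⁆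
    rkT-pH≤ = begin
      rkT (preimage H)   ≡⟨ trans (rkT-preimage H) (rk-cl ⁅ π j ⁆) ⟩
      rk ⁅ π j ⁆         ≤⟨ ≤-pred (≰⇒> 2≰rk) ⟩
      1                  ≤⟨ rkT-loopless j ⟩
      rkT ⁅ j ⁆          ∎
      where open ≤-Reasoning
    pH⊆X : preimage H ⊆ X
    pH⊆X = proj₂ (proj₂ (F̃.isClosure-sameRank (⁅x⁆⊆ j∈pH) pH-flat rkT-pH≤)) X X-flat (⁅x⁆⊆ j∈X)

  InGt⇒Kind : ∀ {X} → InGt X → Kind X
  InGt⇒Kind = [ inj₁ , atom-kind ]′

  preimage-cl-isClosure : ∀ A → IsClosure rkT (preimage A) (preimage (cl A))
  preimage-cl-isClosure A = F̃.isClosure-sameRank (preimage-mono (A⊆cl A)) (preimage-flat (cl-flat A))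
    (≤-reflexive (trans (rkT-preimage (cl A)) (trans (rk-cl A) (sym (rkT-preimage A)))))

  strict-chain : ∀ {F Gs} → F ⊂ ⊤ → All (λ G → IsFlat rk G × G ⊂ ⊤) Gs → All (F ⊂_) Gs → AllPairs _⊂_ Gs →
                 StrictChainFrom F Gs
  strict-chain F⊂⊤ []                          []           []                 = end F⊂⊤
  strict-chain F⊂⊤ ((G-flat , G⊂⊤) ∷ Gs-ok) (F⊂G ∷ _) (G⊂Gs ∷ increasing) =
    step G-flat F⊂G (strict-chain G⊂⊤ Gs-ok G⊂Gs increasing)

-- Every cone of Σ_P is a cone of Σ_{P,𝒢}

module ΣP⊆Bergman {n : ℕ} (P : Polymatroid n) {Fs : List (Subset n)} {S : Subset (Lift.m P)}
                  (flag : Lift.IsFlagOfFlats P Fs) (adm : Lift.Admissible P Fs S) where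
  open Polymatroid P
  open Lift P
  open PolymatroidFlats P
  open LiftedMatroid P

  N : List (Subset m)
  N = gensΣP Fs S

  2≤rk : ∀ {j} → j ∈ S → 2 ≤ rk ⁅ π j ⁆
  2≤rk j∈S = Free-⊥⇒2≤rk (adm ⊥ (here refl)) (x∈p∧x∉q⇒x∈p─q j∈S ∉preimage-⊥)

  generator-flat : ∀ {X} → X ∈ˡ N → IsFlat rkT X × Nonempty X
  generator-flat X∈N with ∈-gensΣP⁻ X∈N
  ... | inj₁ (G , G∈ , refl) = let G-flat , (_ , i , i∈G , _) , _ = chain-member (proj₂ flag) G∈ in
                               preimage-flat G-flat , preimage-nonempty (i , i∈G)
  ... | inj₂ (j , j∈S , refl) = singleton-flat j (2≤rk j∈S) , j , x∈⁅x⁆ j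

  generator-InGt : ∀ {X} → X ∈ˡ N → InGt X
  generator-InGt X∈N with ∈-gensΣP⁻ X∈N
  ... | inj₁ (G , G∈ , refl) = let G-flat , (_ , i , i∈G , _) , _ = chain-member (proj₂ flag) G∈ in
                               inj₁ (G , (G-flat , i , i∈G) , refl)
  ... | inj₂ (j , j∈S , refl) = inj₂ (singleton-atom j (2≤rk j∈S))

  ⊤∉N : ¬ ⊤ ∈ˡ N
  ⊤∉N ⊤∈N with ∈-gensΣP⁻ ⊤∈N
  ... | inj₁ (G , G∈ , ⊤≡) =
    ⊂-irref (sym (preimage-injective (trans preimage-⊤ ⊤≡))) (proj₂ (proj₂ (chain-member (proj₂ flag) G∈)))
  ... | inj₂ (j , j∈S , ⊤≡) = ¬preimage⁅⁆⊆⁅⁆ j (2≤rk j∈S) (⊆-reflexive ⊤≡ ∘ ⊆⊤)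

  findPreimage : ∀ L → All (_∈ˡ N) L →
                 (∃ λ G → G ∈ˡ Fs × preimage G ∈ˡ L) ⊎ (∀ {X} → X ∈ˡ L → ∃ λ j → j ∈ S × X ≡ ⁅ j ⁆)
  findPreimage []       []             = inj₂ λ ()
  findPreimage (X ∷ L) (X∈N ∷ L⊆N) with ∈-gensΣP⁻ X∈N | findPreimage L L⊆N
  ... | inj₁ (G , G∈ , X≡) | _                    = inj₁ (G , G∈ , here (sym X≡))
  ... | inj₂ _             | inj₁ (G , G∈ , pG∈L) = inj₁ (G , G∈ , there pG∈L)
  ... | inj₂ X-singleton   | inj₂ L-singletons    =
    inj₂ λ { (here refl) → X-singleton ; (there X∈L) → L-singletons X∈L }

  record AntichainShape (L : List (Subset m)) : Set where
    field
      F      : Subset n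
      F∈     : F ∈ˡ (⊥ ∷ Fs)
      pF⊆⋃L  : preimage F ⊆ ⋃ L
      kind   : ∀ {X} → X ∈ˡ L → X ≡ preimage F ⊎ ∃ λ j → j ∈ S ─ preimage F × X ≡ ⁅ j ⁆

    T : Subset m
    T = ⋃ L ─ preimage F

    ⋃L≡ : ⋃ L ≡ preimage F ∪ T
    ⋃L≡ = ⊆-antisym (p⊆q∪[p─q] (⋃ L) (preimage F)) (∪-least pF⊆⋃L (p─q⊆p (⋃ L) (preimage F)))

    T∩F=∅ : ∀ {j} → j ∈ T → j ∉ preimage F
    T∩F=∅ = proj₂ ∘ x∈p─q⁻ (⋃ L) (preimage F)

    T⊆S─pF : T ⊆ S ─ preimage F
    T⊆S─pF {j} j∈T with ∈-⋃⁻ L (proj₁ (x∈p─q⁻ (⋃ L) (preimage F) j∈T))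
    ... | Z , Z∈L , j∈Z with kind Z∈L
    ...   | inj₁ refl              = ⊥-elim (T∩F=∅ j∈T j∈Z)
    ...   | inj₂ (j′ , j′∈ , refl) = subst (_∈ S ─ preimage F) (sym (x∈⁅y⁆⇒x≡y j′ j∈Z)) j′∈

    T-free : Free F T
    T-free = Free-mono T⊆S─pF (adm F F∈)

    T≠∅ : ∀ {X Y} → X ∈ˡ L → Y ∈ˡ L → X ≢ Y → Nonempty T
    T≠∅ X∈L Y∈L X≢Y with kind X∈L | kind Y∈L
    ... | inj₁ X≡pF              | inj₁ Y≡pF = ⊥-elim (X≢Y (trans X≡pF (sym Y≡pF)))
    ... | inj₂ (j , j∈ , refl) | _                    = j , x∈p∧x∉q⇒x∈p─q (∈-⋃⁺ L X∈L (x∈⁅x⁆ j)) (proj₂ (x∈p─q⁻ S _ j∈))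
    ... | inj₁ _               | inj₂ (j , j∈ , refl) = j , x∈p∧x∉q⇒x∈p─q (∈-⋃⁺ L Y∈L (x∈⁅x⁆ j)) (proj₂ (x∈p─q⁻ S _ j∈))

    closure≡ : ∀ {C} → IsClosure rkT (⋃ L) C → C ≡ preimage F ∪ T
    closure≡ {C} C-closure = F̃.isClosure-flat (FreeExtension.U-flat (flag-flat flag F∈) T∩F=∅ T-free)
                                               (subst (λ Z → IsClosure rkT Z C) ⋃L≡ C-closure)

  antichain-shape : ∀ L → All (_∈ˡ N) L → AllPairs Incomparable L → AntichainShape L
  antichain-shape L L⊆N antichain with findPreimage L L⊆N
  ... | inj₁ (G , G∈ , pG∈L) = record { F = G ; F∈ = there G∈ ; pF⊆⋃L = ∈-⋃⁺ L pG∈L ; kind = kind }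
    where
    kind : ∀ {X} → X ∈ˡ L → X ≡ preimage G ⊎ ∃ λ j → j ∈ S ─ preimage G × X ≡ ⁅ j ⁆
    kind X∈L with ∈-gensΣP⁻ (All.lookup L⊆N X∈L)
    ... | inj₁ (G′ , G′∈ , refl) =
      inj₁ (antichain-≡ antichain X∈L pG∈L
              ([ inj₁ ∘ preimage-mono , inj₂ ∘ preimage-mono ]′ (chain-comparable (proj₂ flag) G′∈ G∈)))
    ... | inj₂ (j , j∈S , refl) with j ∈? preimage G
    ...   | no  j∉pG = inj₂ (j , x∈p∧x∉q⇒x∈p─q j∈S j∉pG , refl)
    ...   | yes j∈pG = ⊥-elim (¬preimage⁅⁆⊆⁅⁆ j (2≤rk j∈S)
                               (⊆-reflexive (sym ⁅j⁆≡pG) ∘ preimage-mono (⁅x⁆⊆ (∈-preimage⁻ {G} j∈pG))))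
      where ⁅j⁆≡pG = antichain-≡ antichain X∈L pG∈L (inj₁ (⁅x⁆⊆ j∈pG))
  ... | inj₂ singletons = record { F = ⊥ ; F∈ = here refl ; pF⊆⋃L = ⊥-elim ∘ ∉preimage-⊥ ; kind = kind }
    where
    kind : ∀ {X} → X ∈ˡ L → X ≡ preimage ⊥ ⊎ ∃ λ j → j ∈ S ─ preimage ⊥ × X ≡ ⁅ j ⁆
    kind X∈L = let j , j∈S , X≡ = singletons X∈L in inj₂ (j , x∈p∧x∉q⇒x∈p─q j∈S ∉preimage-⊥ , X≡)

  closure-∉G̃ : ∀ L → All (_∈ˡ N) L → 2 ≤ length L → AllPairs Incomparable L →
               ∀ C → IsClosure rkT (unionAll L) C → ¬ InGt C
  closure-∉G̃ L@(X ∷ Y ∷ _) L⊆N (s≤s (s≤s _)) antichain@((X#Y ∷ _) ∷ _) C C-closure =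
    [ not-preimage , not-atom ]′ ∘ subst InGt (closure≡ C-closure)
    where
    open AntichainShape (antichain-shape L L⊆N antichain)
    ⊆U : ∀ {Z} → Z ∈ˡ L → Z ⊆ preimage F ∪ T
    ⊆U Z∈L = subst (_ ⊆_) ⋃L≡ (∈-⋃⁺ L Z∈L)
    not-preimage : ¬ (∃ λ G → InG G × preimage F ∪ T ≡ preimage G)
    not-preimage (G , _ , U≡pG) =
      free-extension-¬preimage {G = G} T∩F=∅ T-free (T≠∅ (here refl) (there (here refl)) (proj₁ X#Y ∘ ⊆-reflexive)) U≡pG
    not-atom : ¬ IsAtom rkT (preimage F ∪ T)
    not-atom atom = let y , y∈Y , y∉X = ⊈⇒∃ (proj₂ X#Y) ; X-flat , X≠∅ = generator-flat (All.lookup L⊆N (here refl)) in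
      y∉X (F̃.atom-minimal atom X-flat X≠∅ (⊆U (here refl)) (⊆U (there (here refl)) y∈Y))

  Bergman-cone : Σ (List (Subset m)) λ N′ → IsNested N′ × ¬ (⊤ ∈ˡ N′) × SameCone N′ N
  Bergman-cone = N , (All.tabulate generator-InGt , closure-∉G̃) , ⊤∉N , sameCone id id

-- Every cone of Σ_{P,𝒢} is a cone of Σ_P

module Bergman⊆ΣP {n : ℕ} (P : Polymatroid n) (n>0 : 0 < n) {N : List (Subset (Lift.m P))}
                  (nested : Lift.IsNested P N) (⊤∉N : ¬ ⊤ ∈ˡ N) where
  open Polymatroid P
  open Lift P
  open PolymatroidFlats P
  open LiftedMatroid P

  closure-∉G̃ : ∀ L → All (_∈ˡ N) L → 2 ≤ length L → AllPairs Incomparable L →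
               ∀ C → IsClosure rkT (unionAll L) C → ¬ InGt C
  closure-∉G̃ = proj₂ nested

  kind : ∀ {X} → X ∈ˡ N → Kind X
  kind X∈N = InGt⇒Kind (All.lookup (proj₁ nested) X∈N)

  _∈N? : ∀ X → Dec (X ∈ˡ N)
  X ∈N? = X ∈ˡ? N
    where open import Data.List.Membership.DecPropositional (≡-dec {n = m} Bool._≟_) using () renaming (_∈?_ to _∈ˡ?_)

  preimage-member⇒⊂⊤ : ∀ {G} → preimage G ∈ˡ N → G ⊂ ⊤
  preimage-member⇒⊂⊤ pG∈N =
    ⊆⊤ , ⊈⇒∃ λ ⊤⊆G → ⊤∉N (subst (_∈ˡ N) (trans (cong preimage (⊆-antisym ⊆⊤ ⊤⊆G)) preimage-⊤) pG∈N)

  preimage-member : ∀ {G} → preimage G ∈ˡ N → IsFlat rk G × Nonempty G × G ⊂ ⊤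
  preimage-member {G} pG∈N with kind pG∈N
  ... | inj₁ (G′ , G′∈G , pG≡pG′) =
    let G-flat , G≠∅ = subst InG (sym (preimage-injective {G} pG≡pG′)) G′∈G in G-flat , G≠∅ , preimage-member⇒⊂⊤ pG∈N
  ... | inj₂ (j , 2≤rk , pG≡⁅j⁆) = ⊥-elim (¬preimage⁅⁆⊆⁅⁆ j 2≤rk (⊆-reflexive pG≡⁅j⁆ ∘ preimage-mono (⁅x⁆⊆ πj∈G)))
    where
    πj∈G : π j ∈ G
    πj∈G = ∈-preimage⁻ (subst (j ∈_) (sym pG≡⁅j⁆) (x∈⁅x⁆ j))

  preimages-comparable : ∀ {G G′} → preimage G ∈ˡ N → preimage G′ ∈ˡ N → G ⊆ G′ ⊎ G′ ⊆ G
  preimages-comparable {G} {G′} pG∈N pG′∈N with G ⊆? G′ | G′ ⊆? G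
  ... | yes G⊆G′ | _        = inj₁ G⊆G′
  ... | no  _    | yes G′⊆G = inj₂ G′⊆G
  ... | no  G⊈G′ | no  G′⊈G = ⊥-elim (closure-∉G̃ (preimage G ∷ preimage G′ ∷ []) (pG∈N ∷ pG′∈N ∷ []) (s≤s (s≤s z≤n))
                                        (((G⊈G′ ∘ preimage-reflects-⊆ , G′⊈G ∘ preimage-reflects-⊆) ∷ []) ∷ [] ∷ [])
                                        (preimage H) closure (inj₁ (H , (cl-flat (G ∪ G′) , H≠∅) , refl)))
    where
    H = cl (G ∪ G′)
    H≠∅ : Nonempty H
    H≠∅ = let i , i∈G = proj₁ (proj₂ (preimage-member pG∈N)) in i , A⊆cl (G ∪ G′) (p⊆p∪q G′ i∈G)
    closure : IsClosure rkT (preimage G ∪ (preimage G′ ∪ ⊥)) (preimage H)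
    closure = subst (λ Z → IsClosure rkT Z (preimage H))
                    (trans (preimage-∪ G G′) (cong (preimage G ∪_) (sym (∪-identityʳ (preimage G′)))))
                    (preimage-cl-isClosure (G ∪ G′))

  PreimageOfSize : ℕ → Subset n → Set
  PreimageOfSize k G = ∣ G ∣ ≡ k × preimage G ∈ˡ N

  pick : ∀ k → (∃ (PreimageOfSize k)) ⊎ (∀ G → ¬ PreimageOfSize k G)
  pick k with Any.any? (λ G → (∣ G ∣ ≟ k) ×-dec (preimage G ∈N?)) (allSubsets n)
  ... | yes ∃G = inj₁ (Any.satisfied ∃G)
  ... | no  ∄G = inj₂ λ G G-ok → ∄G (Any.map (λ { refl → G-ok }) (∈-allSubsets G))

  -- N contains at most one preimage of each size, so listing them by increasing size gives a chain.
  chain : ℕ → ℕ → List (Subset n)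
  chain k zero    = []
  chain k (suc f) with pick k
  ... | inj₁ (G , _) = G ∷ chain (suc k) f
  ... | inj₂ _       = chain (suc k) f

  chain-sound : ∀ k f {G} → G ∈ˡ chain k f → k ≤ ∣ G ∣ × preimage G ∈ˡ N
  chain-sound k (suc f) G∈ with pick k
  chain-sound k (suc f) (here refl) | inj₁ (G , ∣G∣≡k , pG∈N) = ≤-reflexive (sym ∣G∣≡k) , pG∈N
  chain-sound k (suc f) (there G∈)  | inj₁ _ = let k<∣G∣ , pG∈N = chain-sound (suc k) f G∈ in <⇒≤ k<∣G∣ , pG∈N
  chain-sound k (suc f) G∈          | inj₂ _ = let k<∣G∣ , pG∈N = chain-sound (suc k) f G∈ in <⇒≤ k<∣G∣ , pG∈N

  smaller⇒⊂ : ∀ {G G′} → preimage G ∈ˡ N → preimage G′ ∈ˡ N → ∣ G ∣ < ∣ G′ ∣ → G ⊂ G′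
  smaller⇒⊂ {G} {G′} pG∈N pG′∈N ∣G∣<∣G′∣ with preimages-comparable pG∈N pG′∈N
  ... | inj₂ G′⊆G = ⊥-elim (<⇒≱ ∣G∣<∣G′∣ (p⊆q⇒∣p∣≤∣q∣ G′⊆G))
  ... | inj₁ G⊆G′ = G⊆G′ , ⊈⇒∃ λ G′⊆G → <⇒≱ ∣G∣<∣G′∣ (p⊆q⇒∣p∣≤∣q∣ G′⊆G)

  same-size⇒≡ : ∀ {G G′} → preimage G ∈ˡ N → preimage G′ ∈ˡ N → ∣ G ∣ ≡ ∣ G′ ∣ → G ≡ G′
  same-size⇒≡ {G} {G′} pG∈N pG′∈N ∣G∣≡∣G′∣ with preimages-comparable pG∈N pG′∈N
  ... | inj₁ G⊆G′ = ⊆-antisym G⊆G′ (⊆-by-size G⊆G′ (≤-reflexive (sym ∣G∣≡∣G′∣)))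
  ... | inj₂ G′⊆G = sym (⊆-antisym G′⊆G (⊆-by-size G′⊆G (≤-reflexive ∣G∣≡∣G′∣)))

  chain-increasing : ∀ k f → AllPairs _⊂_ (chain k f)
  chain-increasing k zero    = []
  chain-increasing k (suc f) with pick k
  ... | inj₁ (G , ∣G∣≡k , pG∈N) =
        All.tabulate (λ G′∈ → let k<∣G′∣ , pG′∈N = chain-sound (suc k) f G′∈ in
                              smaller⇒⊂ pG∈N pG′∈N (subst (_< _) (sym ∣G∣≡k) k<∣G′∣))
        ∷ chain-increasing (suc k) f
  ... | inj₂ _ = chain-increasing (suc k) f

  chain-suc : ∀ k f {G} → G ∈ˡ chain (suc k) f → G ∈ˡ chain k (suc f)
  chain-suc k f G∈ with pick k
  ... | inj₁ _ = there G∈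
  ... | inj₂ _ = G∈

  chain-complete : ∀ k f {G} → preimage G ∈ˡ N → k ≤ ∣ G ∣ → ∣ G ∣ < k + f → G ∈ˡ chain k f
  chain-complete k zero    {G} _    k≤∣G∣ ∣G∣<k+0 = ⊥-elim (<⇒≱ (subst (∣ G ∣ <_) (+-identityʳ k) ∣G∣<k+0) k≤∣G∣)
  chain-complete k (suc f) {G} pG∈N k≤∣G∣ ∣G∣<k+f with ∣ G ∣ ≟ k
  ... | no  ∣G∣≢k = chain-suc k f (chain-complete (suc k) f pG∈N (≤∧≢⇒< k≤∣G∣ (∣G∣≢k ∘ sym))
                                                               (subst (∣ G ∣ <_) (+-suc k f) ∣G∣<k+f))
  ... | yes ∣G∣≡k with pick k
  ...   | inj₁ (G′ , ∣G′∣≡k , pG′∈N) = here (same-size⇒≡ pG∈N pG′∈N (trans ∣G∣≡k (sym ∣G′∣≡k)))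
  ...   | inj₂ none                  = ⊥-elim (none G (∣G∣≡k , pG∈N))

  Fs : List (Subset n)
  Fs = chain 1 n

  Fs-sound : ∀ {G} → G ∈ˡ Fs → preimage G ∈ˡ N
  Fs-sound = proj₂ ∘ chain-sound 1 n

  Fs-complete : ∀ {G} → preimage G ∈ˡ N → G ∈ˡ Fs
  Fs-complete {G} pG∈N = chain-complete 1 n pG∈N (∣p∣>0 (proj₁ (proj₂ (preimage-member {G} pG∈N)))) (s≤s (∣p∣≤n G))

  flag : IsFlagOfFlats Fs
  flag = ⊥-flat , strict-chain (⊥⊆ , Fin.fromℕ< n>0 , ∈⊤ , ∉⊥)
    (All.tabulate λ G∈ → let G-flat , _ , G⊂⊤ = preimage-member (Fs-sound G∈) in G-flat , G⊂⊤)
    (All.tabulate λ G∈ → let _ , (i , i∈G) , _ = preimage-member (Fs-sound G∈) in ⊥⊆ , i , i∈G , ∉⊥)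
    (chain-increasing 1 n)

  inS : Fin m → Bool
  inS j = ⌊ ⁅ j ⁆ ∈N? ⌋ ∧ ⌊ 2 ≤? rk ⁅ π j ⁆ ⌋

  S : Subset m
  S = tabulate inS

  ∈-S⁺ : ∀ {j} → ⁅ j ⁆ ∈ˡ N → 2 ≤ rk ⁅ π j ⁆ → j ∈ S
  ∈-S⁺ {j} ⁅j⁆∈N 2≤rk = ∈-tabulate⁺ (Equivalence.from (T-∧ {⌊ ⁅ j ⁆ ∈N? ⌋}) (fromWitness ⁅j⁆∈N , fromWitness 2≤rk))

  ∈-S⁻ : ∀ {j} → j ∈ S → ⁅ j ⁆ ∈ˡ N × 2 ≤ rk ⁅ π j ⁆
  ∈-S⁻ {j} j∈S =
    let ⁅j⁆∈N , 2≤rk = Equivalence.to (T-∧ {⌊ ⁅ j ⁆ ∈N? ⌋}) (∈-tabulate⁻ {f = inS} j∈S)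
    in toWitness ⁅j⁆∈N , toWitness 2≤rk

  same-generators : SameCone N (gensΣP Fs S)
  same-generators = sameCone N⊆gens gens⊆N
    where
    N⊆gens : ∀ {X} → X ∈ˡ N → X ∈ˡ gensΣP Fs S
    N⊆gens X∈N with kind X∈N
    ... | inj₁ (G , _ , refl)      = ∈-++⁺ˡ (∈-map⁺ preimage (Fs-complete {G} X∈N))
    ... | inj₂ (j , 2≤rk , refl)   = ∈-++⁺ʳ (map preimage Fs) (∈-map⁺ ⁅_⁆ (∈-elements⁺ (∈-S⁺ X∈N 2≤rk)))
    gens⊆N : ∀ {X} → X ∈ˡ gensΣP Fs S → X ∈ˡ N
    gens⊆N X∈ with ∈-gensΣP⁻ X∈
    ... | inj₁ (G , G∈ , refl)    = Fs-sound G∈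
    ... | inj₂ (j , j∈S , refl)   = proj₁ (∈-S⁻ j∈S)

  singletons : Subset m → List (Subset m)
  singletons T = map ⁅_⁆ (elements T)

  length-singletons : ∀ T → length (singletons T) ≡ ∣ T ∣
  length-singletons T = trans (length-map ⁅_⁆ (elements T)) (length-elements T)

  violation-antichain : ∀ {F T} → F ∈ˡ (⊥ ∷ Fs) → T ⊆ S ─ preimage F → Nonempty T → rk (F ∪ image T) ≤ rk F + ∣ T ∣ →
                        Σ (List (Subset m)) λ L → All (_∈ˡ N) L × 2 ≤ length L × AllPairs Incomparable L ×
                                                   unionAll L ≡ preimage F ∪ T
  violation-antichain {F} {T} F∈ T⊆ (x , x∈T) rk≤ with F∈
  ... | here refl = singletons T , singletons⊆N , 2≤|T| , singletons-antichain T ,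
                    trans (⋃-singletons T) (sym (trans (cong (_∪ T) preimage-⊥) (∪-identityˡ T)))
    where
    2≤|T| : 2 ≤ length (singletons T)
    2≤|T| = begin
      2                        ≤⟨ proj₂ (∈-S⁻ (proj₁ (x∈p─q⁻ S _ (T⊆ x∈T)))) ⟩
      rk ⁅ π x ⁆               ≤⟨ monotone _ _ (⁅x⁆⊆ (q⊆p∪q ⊥ (image T) (∈-image⁺ x∈T))) ⟩
      rk (⊥ ∪ image T)         ≤⟨ rk≤ ⟩
      rk ⊥ + ∣ T ∣             ≡⟨ cong (_+ ∣ T ∣) rk-∅ ⟩
      ∣ T ∣                    ≡⟨ length-singletons T ⟨
      length (singletons T)    ∎
      where open ≤-Reasoning
    singletons⊆N : All (_∈ˡ N) (singletons T)
    singletons⊆N = All.map⁺ (All.tabulate λ j∈ → proj₁ (∈-S⁻ (proj₁ (x∈p─q⁻ S _ (T⊆ (∈-elements⁻ j∈))))))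
  ... | there G∈ = preimage F ∷ singletons T , Fs-sound G∈ ∷ singletons⊆N ,
                   s≤s (subst (1 ≤_) (sym (length-singletons T)) (∣p∣>0 (x , x∈T))) ,
                   All.map⁺ (All.tabulate (incomparable ∘ ∈-elements⁻)) ∷ singletons-antichain T ,
                   cong (preimage F ∪_) (⋃-singletons T)
    where
    singletons⊆N : All (_∈ˡ N) (singletons T)
    singletons⊆N = All.map⁺ (All.tabulate λ j∈ → proj₁ (∈-S⁻ (proj₁ (x∈p─q⁻ S _ (T⊆ (∈-elements⁻ j∈))))))
    incomparable : ∀ {j} → j ∈ T → Incomparable (preimage F) ⁅ j ⁆
    incomparable {j} j∈T = (λ pF⊆⁅j⁆ → j∉pF (subst (_∈ preimage F) (x∈⁅y⁆⇒x≡y j (pF⊆⁅j⁆ y∈pF)) y∈pF)) , j∉pF ∘ ⁅x⁆⊆⁻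
      where
      j∉pF = proj₂ (x∈p─q⁻ S _ (T⊆ j∈T))
      ⁅x⁆⊆⁻ : ⁅ j ⁆ ⊆ preimage F → j ∈ preimage F
      ⁅x⁆⊆⁻ ⊆pF = ⊆pF (x∈⁅x⁆ j)
      y∈pF = proj₂ (preimage-nonempty (proj₁ (proj₂ (preimage-member {F} (Fs-sound G∈)))))

  -- By induction on ∣ T ∣: T minus a point is free, so π⁻¹(F) ∪ T has rank rk F + ∣ T ∣ in P̃,
  -- and a violation would make the closure π⁻¹(cl (F ∪ π T)) of the antichain above an element of 𝒢̃.
  admissible≤ : ∀ {F} → F ∈ˡ (⊥ ∷ Fs) → ∀ c T → ∣ T ∣ ≤ c → Nonempty T → T ⊆ S ─ preimage F →
                rk F + ∣ T ∣ < rk (F ∪ image T)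
  admissible≤ F∈ zero    T ∣T∣≤0 T≠∅ _ = ⊥-elim (<⇒≱ (∣p∣>0 T≠∅) ∣T∣≤0)
  admissible≤ {F} F∈ (suc c) T ∣T∣≤ (x , x∈T) T⊆ with rk F + ∣ T ∣ <? rk (F ∪ image T)
  ... | yes < = <
  ... | no  ≮ with violation-antichain F∈ T⊆ (x , x∈T) (≮⇒≥ ≮)
  ...   | L , L⊆N , 2≤|L| , antichain , ⋃L≡U =
          ⊥-elim (closure-∉G̃ L L⊆N 2≤|L| antichain (preimage H)
                             (subst (λ Z → IsClosure rkT Z (preimage H)) (sym ⋃L≡U) closure)
                             (inj₁ (H , (cl-flat (F ∪ image T) , π x , A⊆cl _ (q⊆p∪q F _ (∈-image⁺ x∈T))) , refl)))
    where
    H = cl (F ∪ image T)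
    T∩F=∅ : ∀ {j} → j ∈ T → j ∉ preimage F
    T∩F=∅ = proj₂ ∘ x∈p─q⁻ S (preimage F) ∘ T⊆
    T′-free : Free F (T ─ ⁅ x ⁆)
    T′-free T₀ T₀≠∅ T₀⊆T′ = admissible≤ F∈ c T₀ ∣T₀∣≤c T₀≠∅ (T⊆ ∘ p─q⊆p T ⁅ x ⁆ ∘ T₀⊆T′)
      where ∣T₀∣≤c = ≤-pred (≤-trans (s≤s (p⊆q⇒∣p∣≤∣q∣ T₀⊆T′)) (≤-trans (≤-reflexive (sym (∣p∣≡1+∣p-x∣ x∈T))) ∣T∣≤))
    closure : IsClosure rkT (preimage F ∪ T) (preimage H)
    closure = isClosure-preimage-cl (≤-trans (≮⇒≥ ≮) (rkT-∪≥ (flag-flat flag F∈) T∩F=∅ x∈T T′-free))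

  admissible : Admissible Fs S
  admissible F F∈ T T≠∅ T⊆ = admissible≤ F∈ ∣ T ∣ T ≤-refl T≠∅ T⊆

  ΣP-cone : Σ (List (Subset n)) λ Fs′ → Σ (Subset m) λ S′ →
              IsFlagOfFlats Fs′ × Admissible Fs′ S′ × SameCone N (gensΣP Fs′ S′)
  ΣP-cone = Fs , S , flag , admissible , same-generators

lemma3p7 : (n : ℕ) → 0 < n → (P : Polymatroid n) → BergmanFanEqualsΣP P
lemma3p7 n n>0 P = (λ N nested ⊤∉N → Bergman⊆ΣP.ΣP-cone P n>0 nested ⊤∉N)
                 , (λ Fs S flag adm → ΣP⊆Bergman.Bergman-cone P flag adm)
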